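{- For $n\ge 1$ and $3\le k\le 2n-2$, $$f_{2n}(k-1,k)+f_{2n}(k+1,k)=f_{2n}(k,k-1)+f_{2n}(k,k+1).$$
   Context: An increasing tree of size $N$ is a planar binary tree with $N$ nodes labeled bijectively by $1,\dots,N$, the root labeled $1$, each node having $0$, $1$ or $2$ children, each child designated as a left child or a right child (at most one of each), and each node's label smaller than its children's labels. Its rightmost node is the node reached from the root by repeatedly moving to the right child until a node without right child is reached. The tree is complete if every node is either a leaf or has two children, except that when $N$ is even the rightmost node has exactly one child, which is a left child. Let $\mathfrak T_N$ be the set of complete increasing trees of size $N$. For $t\in\mathfrak T_N$: for a node $a$ with children, let $\min a$ be the smallest label of its children; the minimal chain is $a_1=1, a_2=\min a_1,\dots$, continued until a leaf $a_j$ is reached, and $\mathrm{eoc}(t):=a_j$. The node labeled $N$ is a leaf; $\mathrm{pom}(t)$ is the label of its parent. Set $f_{2n}(m,k):=\#\{t\in\mathfrak T_{2n}:\mathrm{eoc}(t)=m,\ \mathrm{pom}(t)=k\}$. -}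

module Defs where

open import Data.Nat using (ℕ; zero; suc; _<_; _≤_; _∸_; _%_; _*_)
open import Data.List using (List; []; _∷_; _++_; map; upTo)
open import Data.List.Relation.Binary.Permutation.Propositional using (_↭_)
open import Data.Product using (_×_; _,_)
open import Data.Sum using (_⊎_)
open import Data.Unit using (⊤)
open import Data.Empty using (⊥)
open import Data.Bool using (if_then_else_)
open import Data.Fin using (Fin)
open import Data.Refinement using (Refinement)
open import Relation.Binary.PropositionalEquality using (_≡_)
open import Relation.Nullary.Decidable using (⌊_⌋)
open import Data.Nat.Properties using (_<?_)
open import Function.Bundles using (_↔_)

data Tree : Set where
  nil  : Tree
  node : Tree → ℕ → Tree → Tree

labels : Tree → List ℕ
labels nil = []
labels (node l a r) = labels l ++ (a ∷ labels r)

NonNil : Tree → Set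
NonNil nil = ⊥
NonNil (node _ _ _) = ⊤

Above : ℕ → Tree → Set
Above a nil = ⊤
Above a (node _ b _) = a < b

Increasing : Tree → Set
Increasing nil = ⊤
Increasing (node l a r) = Above a l × Above a r × Increasing l × Increasing r

RootLabel : ℕ → Tree → Set
RootLabel x nil = ⊥
RootLabel x (node _ a _) = a ≡ x

LabelledBy : ℕ → Tree → Set
LabelledBy N t = labels t ↭ map suc (upTo N)

IncreasingTree : ℕ → Tree → Set
IncreasingTree N t = LabelledBy N t × RootLabel 1 t × Increasing t

ZeroOrTwo : Tree → Tree → Set
ZeroOrTwo l r = (l ≡ nil × r ≡ nil) ⊎ (NonNil l × NonNil r)

AllZeroOrTwo : Tree → Set
AllZeroOrTwo nil = ⊤
AllZeroOrTwo (node l a r) = ZeroOrTwo l r × AllZeroOrTwo l × AllZeroOrTwo r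

-- every node has 0 or 2 children, except the rightmost node, which has
-- exactly one child, a left child
RightmostException : Tree → Set
RightmostException nil = ⊥
RightmostException (node l a nil) = NonNil l × AllZeroOrTwo l
RightmostException (node l a r@(node _ _ _)) =
  NonNil l × AllZeroOrTwo l × RightmostException r

Complete : ℕ → Tree → Set
Complete N t = (N % 2 ≡ 0 × RightmostException t) ⊎ (N % 2 ≡ 1 × AllZeroOrTwo t)

IsCIT : ℕ → Tree → Set
IsCIT N t = IncreasingTree N t × Complete N t

eoc : Tree → ℕ
eoc nil = 0
eoc (node nil a nil) = a
eoc (node l@(node _ _ _) a nil) = eoc l
eoc (node nil a r@(node _ _ _)) = eoc r
eoc (node l@(node _ b _) a r@(node _ c _)) =
  if ⌊ b <? c ⌋ then eoc l else eoc r

data HasChild : Tree → ℕ → ℕ → Set where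
  here-left  : ∀ {l r a b l' r'} → l ≡ node l' b r' → HasChild (node l a r) a b
  here-right : ∀ {l r a b l' r'} → r ≡ node l' b r' → HasChild (node l a r) a b
  in-left    : ∀ {l r a p c} → HasChild l p c → HasChild (node l a r) p c
  in-right   : ∀ {l r a p c} → HasChild r p c → HasChild (node l a r) p c

-- pom t ≡ k, stated relationally: the node labelled N has parent labelled k
PomIs : ℕ → Tree → ℕ → Set
PomIs N t k = HasChild t k N

-- { t ∈ 𝔗_{2n} : eoc t = m, pom t = k }  (proofs irrelevant, so elements are trees)
F : ℕ → ℕ → ℕ → Set
F n m k = Refinement Tree (λ t → IsCIT (2 * n) t × eoc t ≡ m × PomIs (2 * n) t k)

-- f_{2n}(m,k) = x  means  the set above has cardinality x
HasCard : Set → ℕ → Set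
HasCard S x = Fin x ↔ S

-- Let A(y) and B(y) be the trees with (eoc, pom) equal to (y, y + 1) and to (y + 1, y). Swapping the
-- labels y and y + 1 is a bijection between the trees of A(y) in which y and y + 1 are not siblings
-- and the trees of B(y) in which y is not the parent of y + 1. In the other trees of A(y) the leaf y
-- has a sibling y + 1 whose children are N and a subtree Y; moving Y to the place of y and hanging
-- y + 1 and N below y gives a tree of B(y) in which y is the parent of y + 1. This local move reaches
-- every such tree except the exceptional trees E(y), where the cherry y(N, y + 1) is the left child of
-- a node on the right spine: undoing the move there would leave the leaf N as the rightmost node,
-- which completeness forbids. So |B(y)| = |A(y)| + |E(y)|. Finally E(x) and E(x + 1) are in
-- bijection, by another local move when x + 2 is the right sibling of the cherry and by relabelling
-- x ↦ x + 1 ↦ x + 2 ↦ x otherwise. Adding the identities for y = x and y = x + 1, where x = k - 1,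
-- and cancelling |E(x)| = |E(x + 1)| proves the proposition.

module Submission where

open import Defs
open import Data.Nat using (ℕ; zero; suc; _≤_; _<_; _+_; _∸_; _*_; z≤n; s≤s; _≟_; _<?_; _%_; _≡ᵇ_)
open import Data.Nat.Properties
open import Data.Bool using (Bool; true; false; if_then_else_; _∨_; _∧_; T)
open import Data.Bool.Properties using (∨-zeroʳ)
import Data.Bool.Properties as Bool
open import Data.List.Membership.DecPropositional _≟_ using (_∈?_)
open import Data.List using (List; []; _∷_; _++_; map; upTo; applyUpTo)
import Data.List.Properties as List
open import Data.List.Membership.Propositional using (_∈_; _∉_)
open import Data.List.Membership.Propositional.Properties using (∈-map⁻; ∈-++⁺ˡ; ∈-++⁺ʳ; ∈-++⁻; ∈-upTo⁻; ∈-∃++)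
open import Data.List.Relation.Unary.Any using (here; there)
open import Data.List.Relation.Unary.All as All using (All; []; _∷_)
open import Data.List.Relation.Unary.All.Properties using (++⁻ˡ; ++⁻ʳ)
open import Data.List.Relation.Unary.AllPairs using ([]; _∷_)
open import Data.List.Relation.Unary.Unique.Propositional using (Unique)
open import Data.List.Relation.Unary.Unique.Propositional.Properties using (upTo⁺; map⁺)
open import Data.List.Relation.Binary.Permutation.Propositional as Perm using (_↭_; prep; swap; ↭-sym; ↭⇒↭ₛ)
open import Data.List.Relation.Binary.Permutation.Propositional.Properties using (∈-resp-↭)
import Data.List.Relation.Binary.Permutation.Propositional.Properties as Perm
import Relation.Binary.PropositionalEquality as ≡
open import Data.List.Relation.Binary.Permutation.Setoid.Properties (≡.setoid ℕ) using (Unique-resp-↭)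
open import Data.Product using (_×_; _,_; proj₁; proj₂; Σ; map₂)
open import Data.Sum using (_⊎_; inj₁; inj₂; [_,_]′)
import Data.Sum as Sum
open import Data.Unit using (⊤; tt)
open import Data.Empty using (⊥-elim)
open import Data.Fin using (Fin)
open import Data.Fin.Properties using (+↔⊎; cantor-schröder-bernstein)
open import Data.Nat.DivMod using (m*n%n≡0)
open import Data.Refinement using (Refinement; _,_)
open import Data.Refinement.Properties using (value-injective)
open import Data.Irrelevant using ([_])
open import Function.Bundles using (_↔_; mk↔ₛ′; Injection)
open import Function.Properties.Inverse using (↔-sym; ↔-trans; ↔⇒↣)
open import Function.Construct.Identity using (↔-id)
open import Function.Related.Propositional using (module EquationalReasoning)
open import Function.Related.TypeIsomorphisms using (⊎-assoc; ⊎-comm)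
open import Data.Sum.Function.Propositional using (_⊎-↔_)
open import Function.Base using (_∘_)
open import Level using (0ℓ)
open import Relation.Nullary using (¬_; Dec; yes; no; does)
open import Relation.Nullary.Decidable using (⌊_⌋; _×-dec_; _⊎-dec_; recompute; dec-true; dec-false)
open import Relation.Binary using (tri<; tri≈; tri>)
open import Relation.Binary.PropositionalEquality using (_≡_; _≢_; ≢-sym; refl; sym; trans; cong; cong₂; subst; subst₂)

-- Labels, subtrees and parents

root : Tree → ℕ
root nil = 0
root (node _ a _) = a

leaf : ℕ → Tree
leaf a = node nil a nil

data _∈T_ (z : ℕ) : Tree → Set where
  hereT : ∀ {l r} → z ∈T node l z r
  inl   : ∀ {l a r} → z ∈T l → z ∈T node l a r
  inr   : ∀ {l a r} → z ∈T r → z ∈T node l a r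

∈T⇒∈ : ∀ {z t} → z ∈T t → z ∈ labels t
∈T⇒∈ (hereT {l}) = ∈-++⁺ʳ (labels l) (here refl)
∈T⇒∈ (inl p) = ∈-++⁺ˡ (∈T⇒∈ p)
∈T⇒∈ (inr {l} p) = ∈-++⁺ʳ (labels l) (there (∈T⇒∈ p))

∈⇒∈T : ∀ {z} t → z ∈ labels t → z ∈T t
∈⇒∈T nil ()
∈⇒∈T (node l a r) p with ∈-++⁻ (labels l) p
... | inj₁ q = inl (∈⇒∈T l q)
... | inj₂ (here refl) = hereT
... | inj₂ (there q) = inr (∈⇒∈T r q)

Distinct : Tree → Set
Distinct nil = ⊤
Distinct (node l a r) = ¬ (a ∈T l) × ¬ (a ∈T r) × (∀ {z} → z ∈T l → ¬ (z ∈T r)) × Distinct l × Distinct r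

unique-++ : ∀ (xs : List ℕ) {ys} → Unique (xs ++ ys) →
  Unique xs × Unique ys × (∀ {z} → z ∈ xs → z ∉ ys)
unique-++ [] u = [] , u , λ ()
unique-++ (x ∷ xs) (x∉ ∷ u) with unique-++ xs u
... | uxs , uys , disjoint = (++⁻ˡ xs x∉ ∷ uxs) , uys , disjoint′
  where
  disjoint′ : ∀ {z} → z ∈ x ∷ xs → z ∉ _
  disjoint′ (here refl) q = All.lookup (++⁻ʳ xs x∉) q refl
  disjoint′ (there p) q = disjoint p q

Unique⇒Distinct : ∀ t → Unique (labels t) → Distinct t
Unique⇒Distinct nil u = tt
Unique⇒Distinct (node l a r) u with unique-++ (labels l) u
... | ul , (a∉ ∷ ur) , disjoint =
  (λ p → disjoint (∈T⇒∈ p) (here refl)) ,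
  (λ p → All.lookup a∉ (∈T⇒∈ p) refl) ,
  (λ p q → disjoint (∈T⇒∈ p) (there (∈T⇒∈ q))) ,
  Unique⇒Distinct l ul , Unique⇒Distinct r ur

range : ℕ → List ℕ
range N = map suc (upTo N)

data Subtree (s : Tree) : Tree → Set where
  subH : Subtree s s
  subL : ∀ {l a r} → Subtree s l → Subtree s (node l a r)
  subR : ∀ {l a r} → Subtree s r → Subtree s (node l a r)

Subtree-∈T : ∀ {s t z} → Subtree s t → z ∈T s → z ∈T t
Subtree-∈T subH p = p
Subtree-∈T (subL q) p = inl (Subtree-∈T q p)
Subtree-∈T (subR q) p = inr (Subtree-∈T q p)

Subtree-trans : ∀ {s u t} → Subtree s u → Subtree u t → Subtree s t
Subtree-trans p subH = p
Subtree-trans p (subL q) = subL (Subtree-trans p q)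
Subtree-trans p (subR q) = subR (Subtree-trans p q)

Subtree-Distinct : ∀ {s t} → Subtree s t → Distinct t → Distinct s
Subtree-Distinct subH d = d
Subtree-Distinct (subL q) (_ , _ , _ , dl , _) = Subtree-Distinct q dl
Subtree-Distinct (subR q) (_ , _ , _ , _ , dr) = Subtree-Distinct q dr

Subtree-Increasing : ∀ {s t} → Subtree s t → Increasing t → Increasing s
Subtree-Increasing subH i = i
Subtree-Increasing (subL q) (_ , _ , il , _) = Subtree-Increasing q il
Subtree-Increasing (subR q) (_ , _ , _ , ir) = Subtree-Increasing q ir

subtree-unique : ∀ {t z l r l' r'} → Distinct t →
  Subtree (node l z r) t → Subtree (node l' z r') t → l ≡ l' × r ≡ r'
subtree-unique d subH subH = refl , refl
subtree-unique (a∉l , _) subH (subL q) = ⊥-elim (a∉l (Subtree-∈T q hereT))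
subtree-unique (_ , a∉r , _) subH (subR q) = ⊥-elim (a∉r (Subtree-∈T q hereT))
subtree-unique (a∉l , _) (subL p) subH = ⊥-elim (a∉l (Subtree-∈T p hereT))
subtree-unique (_ , a∉r , _) (subR p) subH = ⊥-elim (a∉r (Subtree-∈T p hereT))
subtree-unique (_ , _ , _ , dl , _) (subL p) (subL q) = subtree-unique dl p q
subtree-unique (_ , _ , dj , _) (subL p) (subR q) = ⊥-elim (dj (Subtree-∈T p hereT) (Subtree-∈T q hereT))
subtree-unique (_ , _ , dj , _) (subR p) (subL q) = ⊥-elim (dj (Subtree-∈T q hereT) (Subtree-∈T p hereT))
subtree-unique (_ , _ , _ , _ , dr) (subR p) (subR q) = subtree-unique dr p q

Increasing⇒root≤ : ∀ {t z} → Increasing t → z ∈T t → root t ≤ z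
Increasing⇒root≤ _ hereT = ≤-refl
Increasing⇒root≤ {node (node _ b _) a _} (al , _ , il , _) (inl p) = <⇒≤ (<-≤-trans al (Increasing⇒root≤ il p))
Increasing⇒root≤ {node _ a (node _ b _)} (_ , ar , _ , ir) (inr p) = <⇒≤ (<-≤-trans ar (Increasing⇒root≤ ir p))

RootLabel⇒root≡ : ∀ {a t} → RootLabel a t → root t ≡ a
RootLabel⇒root≡ {t = node _ _ _} e = e

RootLabel⇒NonNil : ∀ {a t} → RootLabel a t → NonNil t
RootLabel⇒NonNil {t = node _ _ _} e = tt

RootLabel⇒∈T : ∀ {a t} → RootLabel a t → a ∈T t
RootLabel⇒∈T {t = node _ _ _} refl = hereT

ChildOf : ℕ → Tree → Tree → Set
ChildOf c l r = RootLabel c l ⊎ RootLabel c r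

HasChild⇒Subtree : ∀ {t p c} → HasChild t p c →
  Σ Tree λ l → Σ Tree λ r → Subtree (node l p r) t × ChildOf c l r
HasChild⇒Subtree (here-left {l} {r} refl) = l , r , subH , inj₁ refl
HasChild⇒Subtree (here-right {l} {r} refl) = l , r , subH , inj₂ refl
HasChild⇒Subtree (in-left h) with HasChild⇒Subtree h
... | l , r , s , c = l , r , subL s , c
HasChild⇒Subtree (in-right h) with HasChild⇒Subtree h
... | l , r , s , c = l , r , subR s , c

Subtree⇒HasChild : ∀ {t p c l r} → Subtree (node l p r) t → ChildOf c l r → HasChild t p c
Subtree⇒HasChild {l = node _ _ _} subH (inj₁ refl) = here-left refl
Subtree⇒HasChild {l = nil} subH (inj₁ ())
Subtree⇒HasChild {r = node _ _ _} subH (inj₂ refl) = here-right refl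
Subtree⇒HasChild {r = nil} subH (inj₂ ())
Subtree⇒HasChild (subL s) c = in-left (Subtree⇒HasChild s c)
Subtree⇒HasChild (subR s) c = in-right (Subtree⇒HasChild s c)

HasChild-Subtree : ∀ {u t p c} → Subtree u t → HasChild u p c → HasChild t p c
HasChild-Subtree s h with HasChild⇒Subtree h
... | l , r , s' , co = Subtree⇒HasChild (Subtree-trans s' s) co

ChildOf-< : ∀ {c l p r} → Increasing (node l p r) → ChildOf c l r → p < c
ChildOf-< {l = node _ _ _} (al , _) (inj₁ refl) = al
ChildOf-< {r = node _ _ _} (_ , ar , _) (inj₂ refl) = ar

ChildOf-∈T : ∀ {c l p r} → ChildOf c l r → c ∈T node l p r
ChildOf-∈T {l = node _ _ _} (inj₁ refl) = inl hereT
ChildOf-∈T {r = node _ _ _} (inj₂ refl) = inr hereT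

HasChild-< : ∀ {t p c} → Increasing t → HasChild t p c → p < c
HasChild-< i h with HasChild⇒Subtree h
... | l , r , s , c = ChildOf-< (Subtree-Increasing s i) c

HasChild-∈T-parent : ∀ {t p c} → HasChild t p c → p ∈T t
HasChild-∈T-parent h with HasChild⇒Subtree h
... | l , r , s , c = Subtree-∈T s hereT

HasChild-∈T-child : ∀ {t p c} → HasChild t p c → c ∈T t
HasChild-∈T-child h with HasChild⇒Subtree h
... | l , r , s , c = Subtree-∈T s (ChildOf-∈T c)

Subtree-RootLabel-unique : ∀ {t u v z} → Distinct t → Subtree u t → Subtree v t →
  RootLabel z u → RootLabel z v → u ≡ v
Subtree-RootLabel-unique {u = node _ _ _} {node _ _ _} d su sv refl refl with subtree-unique d su sv
... | refl , refl = refl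

root-not-child : ∀ {t p} → Increasing t → ¬ HasChild t p (root t)
root-not-child i h = <-irrefl refl (<-≤-trans (HasChild-< i h) (Increasing⇒root≤ i (HasChild-∈T-parent h)))

parent-unique : ∀ {t q q' x} → Distinct t → Increasing t → HasChild t q x → HasChild t q' x → q ≡ q'
parent-unique d i (here-left _) (here-left _) = refl
parent-unique d i (here-right _) (here-right _) = refl
parent-unique d i (here-right _) (here-left _) = refl
parent-unique d i (here-left _) (here-right _) = refl
parent-unique d (_ , _ , il , _) (here-left refl) (in-left h) = ⊥-elim (root-not-child il h)
parent-unique d (_ , _ , _ , ir) (here-right refl) (in-right h) = ⊥-elim (root-not-child ir h)
parent-unique d (_ , _ , il , _) (in-left h) (here-left refl) = ⊥-elim (root-not-child il h)
parent-unique d (_ , _ , _ , ir) (in-right h) (here-right refl) = ⊥-elim (root-not-child ir h)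
parent-unique (_ , _ , dj , _) i (here-left refl) (in-right h) = ⊥-elim (dj hereT (HasChild-∈T-child h))
parent-unique (_ , _ , dj , _) i (here-right refl) (in-left h) = ⊥-elim (dj (HasChild-∈T-child h) hereT)
parent-unique (_ , _ , dj , _) i (in-left h) (here-right refl) = ⊥-elim (dj (HasChild-∈T-child h) hereT)
parent-unique (_ , _ , dj , _) i (in-right h) (here-left refl) = ⊥-elim (dj hereT (HasChild-∈T-child h))
parent-unique (_ , _ , _ , dl , _) (_ , _ , il , _) (in-left h) (in-left h') = parent-unique dl il h h'
parent-unique (_ , _ , _ , _ , dr) (_ , _ , _ , ir) (in-right h) (in-right h') = parent-unique dr ir h h'
parent-unique (_ , _ , dj , _) i (in-left h) (in-right h') =
  ⊥-elim (dj (HasChild-∈T-child h) (HasChild-∈T-child h'))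
parent-unique (_ , _ , dj , _) i (in-right h) (in-left h') =
  ⊥-elim (dj (HasChild-∈T-child h') (HasChild-∈T-child h))

parent-node-unique : ∀ {t u a v l p r z} → Distinct t → Increasing t →
  Subtree (node u a v) t → ChildOf z u v → Subtree (node l p r) t → ChildOf z l r → node u a v ≡ node l p r
parent-node-unique d i s₁ c₁ s₂ c₂ with parent-unique d i (Subtree⇒HasChild s₁ c₁) (Subtree⇒HasChild s₂ c₂)
... | refl with subtree-unique d s₁ s₂
... | refl , refl = refl

leaf-noChild : ∀ {t z c} → Distinct t → Subtree (leaf z) t → ¬ HasChild t z c
leaf-noChild d s h with HasChild⇒Subtree h
... | l , r , s' , co with subtree-unique d s s'
... | refl , refl with co
... | inj₁ ()
... | inj₂ ()

leaf-left-child : ∀ {t A p B c} → Distinct t → Subtree (node A p B) t → Subtree (leaf c) t → RootLabel c A →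
  A ≡ leaf c
leaf-left-child {A = node _ _ _} d s sl refl with subtree-unique d (Subtree-trans (subL subH) s) sl
... | refl , refl = refl

leaf-right-child : ∀ {t A p B c} → Distinct t → Subtree (node A p B) t → Subtree (leaf c) t → RootLabel c B →
  B ≡ leaf c
leaf-right-child {B = node _ _ _} d s sl refl with subtree-unique d (Subtree-trans (subR subH) s) sl
... | refl , refl = refl

max-label-leaf : ∀ {N t u} → Increasing t → (∀ {z} → z ∈T t → z ≤ N) →
  Subtree u t → RootLabel N u → u ≡ leaf N
max-label-leaf {N} {t} {node l .N r} i bound s refl =
  cong₂ (λ u v → node u N v) (noChild (subL subH) (proj₁ i')) (noChild (subR subH) (proj₁ (proj₂ i')))
  where
  i' = Subtree-Increasing s i
  noChild : ∀ {u} → Subtree u (node l N r) → Above N u → u ≡ nil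
  noChild {nil} _ _ = refl
  noChild {node _ c _} s' N<c = ⊥-elim (<⇒≱ N<c (bound (Subtree-∈T (Subtree-trans s' s) hereT)))

-- The minimal chain

eoc-branch : ∀ l₁ b l₂ a r₁ c r₂ →
  (b < c × eoc (node (node l₁ b l₂) a (node r₁ c r₂)) ≡ eoc (node l₁ b l₂)) ⊎
  (¬ b < c × eoc (node (node l₁ b l₂) a (node r₁ c r₂)) ≡ eoc (node r₁ c r₂))
eoc-branch l₁ b l₂ a r₁ c r₂ with b <? c
... | yes p = inj₁ (p , refl)
... | no p = inj₂ (p , refl)

eoc-leaf : ∀ t → NonNil t → Subtree (leaf (eoc t)) t
eoc-leaf (node nil a nil) _ = subH
eoc-leaf (node (node l₁ b l₂) a nil) _ = subL (eoc-leaf (node l₁ b l₂) tt)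
eoc-leaf (node nil a (node r₁ c r₂)) _ = subR (eoc-leaf (node r₁ c r₂) tt)
eoc-leaf t@(node l@(node l₁ b l₂) a r@(node r₁ c r₂)) _ =
  [ (λ (_ , e) → subst (λ z → Subtree (leaf z) t) (sym e) (subL (eoc-leaf l tt)))
  , (λ (_ , e) → subst (λ z → Subtree (leaf z) t) (sym e) (subR (eoc-leaf r tt))) ]′
  (eoc-branch l₁ b l₂ a r₁ c r₂)

eoc-∈T : ∀ t → NonNil t → eoc t ∈T t
eoc-∈T t nn = Subtree-∈T (eoc-leaf t nn) hereT

eoc-Subtree : ∀ {s t} → Distinct t → Subtree s t → eoc t ∈T s → eoc t ≡ eoc s
eoc-Subtree d subH p = refl
eoc-Subtree {s} {node nil a r} d (subL q) p with Subtree-∈T q p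
... | ()
eoc-Subtree {s} {node (node l₁ b l₂) a nil} (_ , _ , _ , dl , _) (subL q) p = eoc-Subtree dl q p
eoc-Subtree {s} {node (node l₁ b l₂) a (node r₁ c r₂)} (_ , _ , dj , dl , _) (subL q) p
  with eoc-branch l₁ b l₂ a r₁ c r₂
... | inj₁ (_ , e) = trans e (eoc-Subtree dl q (subst (_∈T s) e p))
... | inj₂ (_ , e) = ⊥-elim (dj (Subtree-∈T q p) (subst (_∈T _) (sym e) (eoc-∈T (node r₁ c r₂) tt)))
eoc-Subtree {s} {node l a nil} d (subR q) p with Subtree-∈T q p
... | ()
eoc-Subtree {s} {node nil a (node r₁ c r₂)} (_ , _ , _ , _ , dr) (subR q) p = eoc-Subtree dr q p
eoc-Subtree {s} {node (node l₁ b l₂) a (node r₁ c r₂)} (_ , _ , dj , _ , dr) (subR q) p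
  with eoc-branch l₁ b l₂ a r₁ c r₂
... | inj₂ (_ , e) = trans e (eoc-Subtree dr q (subst (_∈T s) e p))
... | inj₁ (_ , e) = ⊥-elim (dj (subst (_∈T _) (sym e) (eoc-∈T (node l₁ b l₂) tt)) (Subtree-∈T q p))

chain-left⇒< : ∀ {t u a v} → Distinct t → Subtree (node u a v) t → eoc t ∈T u → NonNil v → root u < root v
chain-left⇒< {t} {node u₁ b u₂} {a} {node v₁ c v₂} d s p _ with eoc-Subtree d s (inl p) | Subtree-Distinct s d
... | e | (_ , _ , dj , _) with eoc-branch u₁ b u₂ a v₁ c v₂
... | inj₁ (lt , _) = lt
... | inj₂ (_ , e₂) = ⊥-elim (dj p (subst (_∈T _) (sym (trans e e₂)) (eoc-∈T (node v₁ c v₂) tt)))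

chain-right⇒≮ : ∀ {t u a v} → Distinct t → Subtree (node u a v) t → eoc t ∈T v → NonNil u → ¬ (root u < root v)
chain-right⇒≮ {t} {node u₁ b u₂} {a} {node v₁ c v₂} d s p _ with eoc-Subtree d s (inr p) | Subtree-Distinct s d
... | e | (_ , _ , dj , _) with eoc-branch u₁ b u₂ a v₁ c v₂
... | inj₂ (≮ , _) = ≮
... | inj₁ (_ , e₂) = ⊥-elim (dj (subst (_∈T _) (sym (trans e e₂)) (eoc-∈T (node u₁ b u₂) tt)) p)

eoc-replace-left : ∀ {l a r} → Distinct (node l a r) → eoc (node l a r) ∈T l →
  ∀ l' → root l' ≡ root l → NonNil l' → eoc (node l' a r) ≡ eoc l'
eoc-replace-left {l} {a} {nil} d p (node _ _ _) e nn = refl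
eoc-replace-left {nil} {a} {node _ _ _} d () l' e nn
eoc-replace-left {node l₁ b l₂} {a} {node r₁ c r₂} (_ , _ , dj , _) p (node l₁' b' l₂') refl nn
  with eoc-branch l₁ b l₂ a r₁ c r₂ | eoc-branch l₁' b l₂' a r₁ c r₂
... | inj₂ (_ , e) | _ = ⊥-elim (dj p (subst (_∈T _) (sym e) (eoc-∈T (node r₁ c r₂) tt)))
... | inj₁ _ | inj₁ (_ , e') = e'
... | inj₁ (lt , _) | inj₂ (≮ , _) = ⊥-elim (≮ lt)

eoc-replace-right : ∀ {l a r} → Distinct (node l a r) → eoc (node l a r) ∈T r →
  ∀ r' → root r' ≡ root r → NonNil r' → eoc (node l a r') ≡ eoc r'
eoc-replace-right {nil} {a} {r} d p (node _ _ _) e nn = refl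
eoc-replace-right {node _ _ _} {a} {nil} d () r' e nn
eoc-replace-right {node l₁ b l₂} {a} {node r₁ c r₂} (_ , _ , dj , _) p (node r₁' c' r₂') refl nn
  with eoc-branch l₁ b l₂ a r₁ c r₂ | eoc-branch l₁ b l₂ a r₁' c r₂'
... | inj₁ (_ , e) | _ = ⊥-elim (dj (subst (_∈T _) (sym e) (eoc-∈T (node l₁ b l₂) tt)) p)
... | inj₂ _ | inj₂ (_ , e') = e'
... | inj₂ (≮ , _) | inj₁ (lt , _) = ⊥-elim (≮ lt)

chain-left-sibling-above : ∀ {t X q Y x} → Distinct t → Subtree (node X q Y) t → eoc t ∈T X →
  RootLabel x X → suc x ∈T X → Above (suc x) Y
chain-left-sibling-above {Y = nil} d s p r 1+x∈ = tt
chain-left-sibling-above {Y = node _ c _} d s p r 1+x∈ =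
  ≤∧≢⇒< (subst (_< c) (RootLabel⇒root≡ r) (chain-left⇒< d s p tt))
        (λ { refl → proj₁ (proj₂ (proj₂ (Subtree-Distinct s d))) 1+x∈ hereT })

chain-right-sibling-above : ∀ {t X q Y x} → Distinct t → Subtree (node Y q X) t → eoc t ∈T X →
  RootLabel x X → suc x ∈T X → x ∈T X → Above (suc x) Y
chain-right-sibling-above {Y = nil} d s p r 1+x∈ x∈ = tt
chain-right-sibling-above {Y = node _ c _} {x} d s p r 1+x∈ x∈ with <-cmp c (suc x)
... | tri> _ _ gt = gt
... | tri≈ _ refl _ = ⊥-elim (disjoint hereT 1+x∈)
  where disjoint = proj₁ (proj₂ (proj₂ (Subtree-Distinct s d)))
... | tri< lt _ _ with m≤n⇒m<n∨m≡n (≤-pred lt)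
...   | inj₂ refl = ⊥-elim (proj₁ (proj₂ (proj₂ (Subtree-Distinct s d))) hereT x∈)
...   | inj₁ c<x = ⊥-elim (chain-right⇒≮ d s p tt (subst (c <_) (sym (RootLabel⇒root≡ r)) c<x))

-- Relabelling

relabel : (ℕ → ℕ) → Tree → Tree
relabel f nil = nil
relabel f (node l a r) = node (relabel f l) (f a) (relabel f r)

labels-relabel : ∀ f t → labels (relabel f t) ≡ map f (labels t)
labels-relabel f nil = refl
labels-relabel f (node l a r) =
  trans (cong₂ (λ u v → u ++ (f a ∷ v)) (labels-relabel f l) (labels-relabel f r))
        (sym (List.map-++ f (labels l) (a ∷ labels r)))

relabel-inverse : ∀ {f g} → (∀ z → f (g z) ≡ z) → ∀ t → relabel f (relabel g t) ≡ t
relabel-inverse fg nil = refl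
relabel-inverse fg (node l a r) =
  cong₂ (λ u (w : ℕ × Tree) → node u (proj₁ w) (proj₂ w))
    (relabel-inverse fg l) (cong₂ _,_ (fg a) (relabel-inverse fg r))

relabel-NonNil : ∀ f t → NonNil t → NonNil (relabel f t)
relabel-NonNil f (node _ _ _) _ = tt

relabel-ZeroOrTwo : ∀ f l r → ZeroOrTwo l r → ZeroOrTwo (relabel f l) (relabel f r)
relabel-ZeroOrTwo f nil nil (inj₁ _) = inj₁ (refl , refl)
relabel-ZeroOrTwo f (node _ _ _) (node _ _ _) (inj₂ _) = inj₂ (tt , tt)
relabel-ZeroOrTwo f nil (node _ _ _) (inj₁ (_ , ()))
relabel-ZeroOrTwo f (node _ _ _) _ (inj₁ (() , _))
relabel-ZeroOrTwo f nil _ (inj₂ (() , _))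
relabel-ZeroOrTwo f (node _ _ _) nil (inj₂ (_ , ()))

relabel-AllZeroOrTwo : ∀ f t → AllZeroOrTwo t → AllZeroOrTwo (relabel f t)
relabel-AllZeroOrTwo f nil _ = tt
relabel-AllZeroOrTwo f (node l a r) (z , al , ar) =
  relabel-ZeroOrTwo f l r z , relabel-AllZeroOrTwo f l al , relabel-AllZeroOrTwo f r ar

relabel-RightmostException : ∀ f t → RightmostException t → RightmostException (relabel f t)
relabel-RightmostException f (node l a nil) (n , z) = relabel-NonNil f l n , relabel-AllZeroOrTwo f l z
relabel-RightmostException f (node l a (node r₁ c r₂)) (n , z , re) =
  relabel-NonNil f l n , relabel-AllZeroOrTwo f l z , relabel-RightmostException f (node r₁ c r₂) re

relabel-Subtree : ∀ f {s t} → Subtree s t → Subtree (relabel f s) (relabel f t)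
relabel-Subtree f subH = subH
relabel-Subtree f (subL q) = subL (relabel-Subtree f q)
relabel-Subtree f (subR q) = subR (relabel-Subtree f q)

relabel-RootLabel : ∀ f {x t} → RootLabel x t → RootLabel (f x) (relabel f t)
relabel-RootLabel f {t = node _ _ _} refl = refl

relabel-HasChild : ∀ f {t p c} → HasChild t p c → HasChild (relabel f t) (f p) (f c)
relabel-HasChild f h with HasChild⇒Subtree h
... | l , r , s , c = Subtree⇒HasChild (relabel-Subtree f s) (Sum.map (relabel-RootLabel f) (relabel-RootLabel f) c)

MapsAbove : (ℕ → ℕ) → ℕ → Tree → Set
MapsAbove f a nil = ⊤
MapsAbove f a (node _ b _) = f a < f b

ReflectsSiblings : (ℕ → ℕ) → Tree → Tree → Set
ReflectsSiblings f (node _ b _) (node _ c _) = (b < c → f b < f c) × (f b < f c → b < c)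
ReflectsSiblings f _ _ = ⊤

Compatible : (ℕ → ℕ) → Tree → Set
Compatible f nil = ⊤
Compatible f (node l a r) =
  MapsAbove f a l × MapsAbove f a r × ReflectsSiblings f l r × Compatible f l × Compatible f r

Compatible-Increasing : ∀ f t → Compatible f t → Increasing (relabel f t)
Compatible-Increasing f nil _ = tt
Compatible-Increasing f (node l a r) (al , ar , _ , cl , cr) =
  above l al , above r ar , Compatible-Increasing f l cl , Compatible-Increasing f r cr
  where
  above : ∀ u → MapsAbove f a u → Above (f a) (relabel f u)
  above nil _ = tt
  above (node _ _ _) p = p

eoc-relabel : ∀ f t → Compatible f t → NonNil t → eoc (relabel f t) ≡ f (eoc t)
eoc-relabel f (node nil a nil) _ _ = refl
eoc-relabel f (node (node l₁ b l₂) a nil) (_ , _ , _ , cl , _) _ = eoc-relabel f (node l₁ b l₂) cl tt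
eoc-relabel f (node nil a (node r₁ c r₂)) (_ , _ , _ , _ , cr) _ = eoc-relabel f (node r₁ c r₂) cr tt
eoc-relabel f (node (node l₁ b l₂) a (node r₁ c r₂)) (_ , _ , sib , cl , cr) _ =
  fork sib (eoc-relabel f (node l₁ b l₂) cl tt) (eoc-relabel f (node r₁ c r₂) cr tt)
  where
  fork : ReflectsSiblings f (node l₁ b l₂) (node r₁ c r₂) →
    eoc (relabel f (node l₁ b l₂)) ≡ f (eoc (node l₁ b l₂)) →
    eoc (relabel f (node r₁ c r₂)) ≡ f (eoc (node r₁ c r₂)) →
    eoc (relabel f (node (node l₁ b l₂) a (node r₁ c r₂))) ≡ f (eoc (node (node l₁ b l₂) a (node r₁ c r₂)))
  fork (b<c⇒ , ⇒b<c) ihl ihr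
    with eoc-branch (relabel f l₁) (f b) (relabel f l₂) (f a) (relabel f r₁) (f c) (relabel f r₂)
       | eoc-branch l₁ b l₂ a r₁ c r₂
  ... | inj₁ (_ , e) | inj₁ (_ , e') = trans e (trans ihl (cong f (sym e')))
  ... | inj₂ (_ , e) | inj₂ (_ , e') = trans e (trans ihr (cong f (sym e')))
  ... | inj₁ (lt , _) | inj₂ (≮ , _) = ⊥-elim (≮ (⇒b<c lt))
  ... | inj₂ (≮ , _) | inj₁ (lt , _) = ⊥-elim (≮ (b<c⇒ lt))

Compatible-from : ∀ f t → Increasing t → (∀ {p c} → HasChild t p c → f p < f c) →
  (∀ {u a v} → Subtree (node u a v) t → ReflectsSiblings f u v) → Compatible f t
Compatible-from f nil _ _ _ = tt
Compatible-from f (node l a r) (_ , _ , il , ir) edge sib =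
  aboveL l refl , aboveR r refl , sib subH ,
  Compatible-from f l il (λ h → edge (in-left h)) (λ s → sib (subL s)) ,
  Compatible-from f r ir (λ h → edge (in-right h)) (λ s → sib (subR s))
  where
  aboveL : ∀ u → u ≡ l → MapsAbove f a u
  aboveL nil _ = tt
  aboveL (node _ _ _) refl = edge (here-left refl)
  aboveR : ∀ u → u ≡ r → MapsAbove f a u
  aboveR nil _ = tt
  aboveR (node _ _ _) refl = edge (here-right refl)

ReflectsSiblings-from : ∀ f {u v} →
  (∀ {b c} → RootLabel b u → RootLabel c v → b < c → f b < f c) →
  (∀ {b c} → RootLabel b u → RootLabel c v → c < b → f c < f b) → ReflectsSiblings f u v
ReflectsSiblings-from f {nil} {v} _ _ = tt
ReflectsSiblings-from f {node _ b _} {nil} _ _ = tt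
ReflectsSiblings-from f {node _ b _} {node _ c _} mono₁ mono₂ = mono₁ refl refl , reflect
  where
  reflect : f b < f c → b < c
  reflect lt with <-cmp b c
  ... | tri< p _ _ = p
  ... | tri≈ _ refl _ = ⊥-elim (<-irrefl refl lt)
  ... | tri> _ _ p = ⊥-elim (<-asym lt (mono₂ refl refl p))

transpose : ℕ → ℕ → ℕ
transpose x z with z ≟ x | z ≟ suc x
... | yes _ | _ = suc x
... | no _ | yes _ = x
... | no _ | no _ = z

transpose-cases : ∀ x z → (z ≡ x × transpose x z ≡ suc x) ⊎ (z ≡ suc x × transpose x z ≡ x) ⊎
  (z ≢ x × z ≢ suc x × transpose x z ≡ z)
transpose-cases x z with z ≟ x | z ≟ suc x
... | yes e | _ = inj₁ (e , refl)
... | no _ | yes e = inj₂ (inj₁ (e , refl))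
... | no z≢x | no z≢1+x = inj₂ (inj₂ (z≢x , z≢1+x , refl))

transpose-x : ∀ x → transpose x x ≡ suc x
transpose-x x with transpose-cases x x
... | inj₁ (_ , e) = e
... | inj₂ (inj₁ (e , _)) = ⊥-elim (1+n≢n (sym e))
... | inj₂ (inj₂ (x≢x , _)) = ⊥-elim (x≢x refl)

transpose-suc : ∀ x → transpose x (suc x) ≡ x
transpose-suc x with transpose-cases x (suc x)
... | inj₁ (e , _) = ⊥-elim (1+n≢n e)
... | inj₂ (inj₁ (_ , e)) = e
... | inj₂ (inj₂ (_ , ≢ , _)) = ⊥-elim (≢ refl)

transpose-other : ∀ x z → z ≢ x → z ≢ suc x → transpose x z ≡ z
transpose-other x z z≢x z≢1+x with transpose-cases x z
... | inj₁ (e , _) = ⊥-elim (z≢x e)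
... | inj₂ (inj₁ (e , _)) = ⊥-elim (z≢1+x e)
... | inj₂ (inj₂ (_ , _ , e)) = e

transpose-< : ∀ x z → z < x → transpose x z ≡ z
transpose-< x z lt = transpose-other x z (<⇒≢ lt) (<⇒≢ (m<n⇒m<1+n lt))

transpose-> : ∀ x z → suc x < z → transpose x z ≡ z
transpose-> x z lt = transpose-other x z (≢-sym (<⇒≢ (<-trans (n<1+n x) lt))) (≢-sym (<⇒≢ lt))

transpose-involutive : ∀ x z → transpose x (transpose x z) ≡ z
transpose-involutive x z with transpose-cases x z
... | inj₁ (refl , e) = trans (cong (transpose x) e) (transpose-suc x)
... | inj₂ (inj₁ (refl , e)) = trans (cong (transpose x) e) (transpose-x x)
... | inj₂ (inj₂ (_ , _ , e)) = trans (cong (transpose x) e) e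

transpose-mono : ∀ x {a b} → a < b → ¬ (a ≡ x × b ≡ suc x) → transpose x a < transpose x b
transpose-mono x {a} {b} lt adjacent with transpose-cases x a | transpose-cases x b
... | inj₁ (refl , ea) | inj₁ (refl , eb) = ⊥-elim (<-irrefl refl lt)
... | inj₁ (refl , ea) | inj₂ (inj₁ (refl , eb)) = ⊥-elim (adjacent (refl , refl))
... | inj₁ (refl , ea) | inj₂ (inj₂ (_ , b≢1+x , eb)) rewrite ea | eb = ≤∧≢⇒< lt (≢-sym b≢1+x)
... | inj₂ (inj₁ (refl , ea)) | inj₁ (refl , eb) = ⊥-elim (<-asym lt (n<1+n x))
... | inj₂ (inj₁ (refl , ea)) | inj₂ (inj₁ (refl , eb)) = ⊥-elim (<-irrefl refl lt)
... | inj₂ (inj₁ (refl , ea)) | inj₂ (inj₂ (_ , _ , eb)) rewrite ea | eb = <-trans (n<1+n x) lt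
... | inj₂ (inj₂ (_ , _ , ea)) | inj₁ (refl , eb) rewrite ea | eb = <-trans lt (n<1+n x)
... | inj₂ (inj₂ (a≢x , _ , ea)) | inj₂ (inj₁ (refl , eb)) rewrite ea | eb = ≤∧≢⇒< (≤-pred lt) a≢x
... | inj₂ (inj₂ (_ , _ , ea)) | inj₂ (inj₂ (_ , _ , eb)) rewrite ea | eb = lt

countFrom : ℕ → ℕ → List ℕ
countFrom a zero = []
countFrom a (suc n) = a ∷ countFrom (suc a) n

applyUpTo-countFrom : ∀ (f : ℕ → ℕ) a n → (∀ i → f i ≡ a + i) → applyUpTo f n ≡ countFrom a n
applyUpTo-countFrom f a zero e = refl
applyUpTo-countFrom f a (suc n) e =
  cong₂ _∷_ (trans (e 0) (+-identityʳ a))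
            (applyUpTo-countFrom (f ∘ suc) (suc a) n (λ i → trans (e (suc i)) (+-suc a i)))

range-countFrom : ∀ N → range N ≡ countFrom 1 N
range-countFrom N = trans (List.map-upTo suc N) (applyUpTo-countFrom suc 1 N (λ i → refl))

countFrom-fixed : ∀ f b n → (∀ z → b ≤ z → f z ≡ z) → map f (countFrom b n) ≡ countFrom b n
countFrom-fixed f b zero fixed = refl
countFrom-fixed f b (suc n) fixed =
  cong₂ _∷_ (fixed b ≤-refl) (countFrom-fixed f (suc b) n (λ z le → fixed z (<⇒≤ le)))

transpose-countFrom : ∀ x a n → a ≤ x → suc x < a + n → map (transpose x) (countFrom a n) ↭ countFrom a n
transpose-countFrom x a zero a≤x lt =
  ⊥-elim (<-irrefl refl (<-≤-trans (<-trans (n<1+n x) lt) (≤-trans (≤-reflexive (+-identityʳ a)) a≤x)))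
transpose-countFrom x a (suc n) a≤x lt = go (m≤n⇒m<n∨m≡n a≤x) n refl
  where
  go : a < x ⊎ a ≡ x → ∀ m → m ≡ n → map (transpose x) (countFrom a (suc n)) ↭ countFrom a (suc n)
  go (inj₁ a<x) _ _ rewrite transpose-< x a a<x =
    prep a (transpose-countFrom x (suc a) n a<x (subst (suc x <_) (+-suc a n) lt))
  go (inj₂ refl) zero refl = ⊥-elim (<-irrefl refl (<-≤-trans lt (≤-reflexive (+-comm a 1))))
  go (inj₂ refl) (suc m) refl
    rewrite transpose-x a | transpose-suc a | countFrom-fixed (transpose a) (suc (suc a)) m (transpose-> a)
    = swap (suc a) a Perm.refl

transpose-range : ∀ x N → 1 ≤ x → suc x ≤ N → map (transpose x) (range N) ↭ range N
transpose-range x N 1≤x 1+x≤N rewrite range-countFrom N = transpose-countFrom x 1 N 1≤x (s≤s 1+x≤N)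

-- x ↦ x + 1 ↦ x + 2 ↦ x
rotate rotate⁻¹ : ℕ → ℕ → ℕ
rotate x z = transpose x (transpose (suc x) z)
rotate⁻¹ x z = transpose (suc x) (transpose x z)

rotate⁻¹-rotate : ∀ x z → rotate⁻¹ x (rotate x z) ≡ z
rotate⁻¹-rotate x z =
  trans (cong (transpose (suc x)) (transpose-involutive x (transpose (suc x) z))) (transpose-involutive (suc x) z)

rotate-rotate⁻¹ : ∀ x z → rotate x (rotate⁻¹ x z) ≡ z
rotate-rotate⁻¹ x z =
  trans (cong (transpose x) (transpose-involutive (suc x) (transpose x z))) (transpose-involutive x z)

rotate-x : ∀ x → rotate x x ≡ suc x
rotate-x x = trans (cong (transpose x) (transpose-< (suc x) x (n<1+n x))) (transpose-x x)

rotate-1+x : ∀ x → rotate x (suc x) ≡ suc (suc x)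
rotate-1+x x = trans (cong (transpose x) (transpose-x (suc x))) (transpose-> x (suc (suc x)) (n<1+n (suc x)))

rotate⁻¹-1+x : ∀ x → rotate⁻¹ x (suc x) ≡ x
rotate⁻¹-1+x x = trans (cong (transpose (suc x)) (transpose-suc x)) (transpose-< (suc x) x (n<1+n x))

rotate⁻¹-2+x : ∀ x → rotate⁻¹ x (suc (suc x)) ≡ suc x
rotate⁻¹-2+x x =
  trans (cong (transpose (suc x)) (transpose-> x (suc (suc x)) (n<1+n (suc x)))) (transpose-suc (suc x))

rotate-< : ∀ x z → z < x → rotate x z ≡ z
rotate-< x z lt = trans (cong (transpose x) (transpose-< (suc x) z (m<n⇒m<1+n lt))) (transpose-< x z lt)

rotate-> : ∀ x z → suc (suc x) < z → rotate x z ≡ z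
rotate-> x z lt = trans (cong (transpose x) (transpose-> (suc x) z lt)) (transpose-> x z (<-trans (n<1+n _) lt))

rotate⁻¹-< : ∀ x z → z < x → rotate⁻¹ x z ≡ z
rotate⁻¹-< x z lt = trans (cong (transpose (suc x)) (transpose-< x z lt)) (transpose-< (suc x) z (m<n⇒m<1+n lt))

rotate⁻¹-> : ∀ x z → suc (suc x) < z → rotate⁻¹ x z ≡ z
rotate⁻¹-> x z lt =
  trans (cong (transpose (suc x)) (transpose-> x z (<-trans (n<1+n _) lt))) (transpose-> (suc x) z lt)

transpose≡x⇒ : ∀ x z → transpose x z ≡ x → z ≡ suc x
transpose≡x⇒ x z e with transpose-cases x z
... | inj₁ (refl , e') = ⊥-elim (1+n≢n (trans (sym e') e))
... | inj₂ (inj₁ (refl , _)) = refl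
... | inj₂ (inj₂ (z≢x , _ , e')) = ⊥-elim (z≢x (trans (sym e') e))

transpose≡1+x⇒ : ∀ x z → transpose x z ≡ suc x → z ≡ x
transpose≡1+x⇒ x z e with transpose-cases x z
... | inj₁ (refl , _) = refl
... | inj₂ (inj₁ (refl , e')) = ⊥-elim (1+n≢n (trans (sym e) e'))
... | inj₂ (inj₂ (_ , z≢1+x , e')) = ⊥-elim (z≢1+x (trans (sym e') e))

rotate-mono : ∀ x {a b} → a < b → ¬ (a ≡ suc x × b ≡ suc (suc x)) → ¬ (a ≡ x × b ≡ suc (suc x)) →
  rotate x a < rotate x b
rotate-mono x {a} {b} lt adj₁ adj₂ = transpose-mono x (transpose-mono (suc x) lt adj₁)
  λ (ea , eb) → adj₂ (a≡x ea , transpose≡x⇒ (suc x) b eb)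
  where
  a≡x : transpose (suc x) a ≡ x → a ≡ x
  a≡x e with transpose-cases (suc x) a
  ... | inj₁ (refl , e') = ⊥-elim (<-irrefl (trans (sym e) e') (<-trans (n<1+n x) (n<1+n (suc x))))
  ... | inj₂ (inj₁ (refl , e')) = ⊥-elim (<-irrefl (trans (sym e) e') (n<1+n x))
  ... | inj₂ (inj₂ (_ , _ , e')) = trans (sym e') e

rotate⁻¹-mono : ∀ x {a b} → a < b → ¬ (a ≡ x × b ≡ suc x) → ¬ (a ≡ x × b ≡ suc (suc x)) →
  rotate⁻¹ x a < rotate⁻¹ x b
rotate⁻¹-mono x {a} {b} lt adj₁ adj₂ = transpose-mono (suc x) (transpose-mono x lt adj₁)
  λ (ea , eb) → adj₂ (transpose≡1+x⇒ x a ea , b≡2+x eb)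
  where
  b≡2+x : transpose x b ≡ suc (suc x) → b ≡ suc (suc x)
  b≡2+x e with transpose-cases x b
  ... | inj₁ (refl , e') = ⊥-elim (<-irrefl (trans (sym e') e) (n<1+n (suc x)))
  ... | inj₂ (inj₁ (refl , e')) = ⊥-elim (<-irrefl (trans (sym e') e) (<-trans (n<1+n x) (n<1+n (suc x))))
  ... | inj₂ (inj₂ (_ , _ , e')) = trans (sym e') e

-- The classes counted by f₂ₙ(m, k)

InClass : ℕ → ℕ → ℕ → Tree → Set
InClass N m k t = IsCIT N t × eoc t ≡ m × PomIs N t k

record Facts (N : ℕ) (t : Tree) : Set where
  field
    distinct : Distinct t
    bounded : ∀ {z} → z ∈T t → z ≤ N
    increasing : Increasing t
    rootLabel : RootLabel 1 t

facts : ∀ {N t} → IsCIT N t → Facts N t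
facts {N} {t} ((perm , r1 , inc) , _) = record
  { distinct = Unique⇒Distinct t (Unique-resp-↭ (↭⇒↭ₛ (↭-sym perm)) (map⁺ suc-injective (upTo⁺ N)))
  ; bounded = λ p → bound (∈-resp-↭ perm (∈T⇒∈ p))
  ; increasing = inc
  ; rootLabel = r1 }
  where
  bound : ∀ {z} → z ∈ range N → z ≤ N
  bound p with ∈-map⁻ suc p
  ... | _ , q , refl = ∈-upTo⁻ q

IsCIT-NonNil : ∀ {N t} → IsCIT N t → NonNil t
IsCIT-NonNil {t = node _ _ _} _ = tt

even-RightmostException : ∀ {N t} → N % 2 ≡ 0 → Complete N t → RightmostException t
even-RightmostException ev (inj₁ (_ , re)) = re
even-RightmostException ev (inj₂ (odd , _)) = ⊥-elim (0≢1+n (trans (sym ev) odd))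

record Relabelling (N : ℕ) (f : ℕ → ℕ) : Set where
  field
    fixes-1 : f 1 ≡ 1
    fixes-N : f N ≡ N
    permutes : map f (range N) ↭ range N

relabel-IsCIT : ∀ {N f t} → Relabelling N f → Compatible f t → IsCIT N t → IsCIT N (relabel f t)
relabel-IsCIT {N} {f} {t} ρ c ((perm , r1 , _) , complete) =
  (subst (_↭ range N) (sym (labels-relabel f t)) (Perm.trans (Perm.map⁺ f perm) (Relabelling.permutes ρ)) ,
   subst (λ z → RootLabel z (relabel f t)) (Relabelling.fixes-1 ρ) (relabel-RootLabel f r1) ,
   Compatible-Increasing f t c) ,
  Sum.map (map₂ (relabel-RightmostException f t)) (map₂ (relabel-AllZeroOrTwo f t)) complete

relabel-InClass : ∀ {N m k f t} → Relabelling N f → Compatible f t →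
  InClass N m k t → InClass N (f m) (f k) (relabel f t)
relabel-InClass {N} {m} {k} {f} {t} ρ c (cit , e , pom) =
  relabel-IsCIT ρ c cit ,
  trans (eoc-relabel f t c (IsCIT-NonNil cit)) (cong f e) ,
  subst (HasChild (relabel f t) (f k)) (Relabelling.fixes-N ρ) (relabel-HasChild f pom)

AreSiblings : ℕ → ℕ → Tree → Set
AreSiblings a b t = Σ Tree λ u → Σ ℕ λ p → Σ Tree λ v → Subtree (node u p v) t ×
  ((RootLabel a u × RootLabel b v) ⊎ (RootLabel b u × RootLabel a v))

Siblings : ℕ → Tree → Set
Siblings x = AreSiblings x (suc x)

AreSiblings-Subtree : ∀ {a b u t} → Subtree u t → AreSiblings a b u → AreSiblings a b t
AreSiblings-Subtree s (u , p , v , s' , h) = u , p , v , Subtree-trans s' s , h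

Siblings-transpose : ∀ x {t} → Siblings x t → Siblings x (relabel (transpose x) t)
Siblings-transpose x (u , a , v , s , sib) =
  relabel τ u , τ a , relabel τ v , relabel-Subtree τ s , swapped sib
  where
  τ = transpose x
  root-τ : ∀ {y z w} → τ y ≡ z → RootLabel y w → RootLabel z (relabel τ w)
  root-τ refl = relabel-RootLabel τ
  swapped : (RootLabel x u × RootLabel (suc x) v) ⊎ (RootLabel (suc x) u × RootLabel x v) →
    (RootLabel x (relabel τ u) × RootLabel (suc x) (relabel τ v)) ⊎
    (RootLabel (suc x) (relabel τ u) × RootLabel x (relabel τ v))
  swapped (inj₁ (ru , rv)) = inj₂ (root-τ (transpose-x x) ru , root-τ (transpose-suc x) rv)
  swapped (inj₂ (ru , rv)) = inj₁ (root-τ (transpose-suc x) ru , root-τ (transpose-x x) rv)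

Compatible-avoiding : ∀ f (Bad : ℕ → ℕ → Set) t → Increasing t →
  (∀ {a b} → a < b → ¬ Bad a b → f a < f b) →
  (∀ {p c} → HasChild t p c → ¬ Bad p c) → (∀ {a b} → AreSiblings a b t → ¬ Bad a b) → Compatible f t
Compatible-avoiding f Bad t inc mono noEdge noSib =
  Compatible-from f t inc (λ h → mono (HasChild-< inc h) (noEdge h)) λ {u} {a} {v} s →
    ReflectsSiblings-from f (λ rb rc lt → mono lt (noSib (u , a , v , s , inj₁ (rb , rc))))
                            (λ rb rc lt → mono lt (noSib (u , a , v , s , inj₂ (rb , rc))))

Compatible-transpose : ∀ x t → Increasing t → ¬ HasChild t x (suc x) → ¬ Siblings x t →
  Compatible (transpose x) t
Compatible-transpose x t inc noEdge noSib =
  Compatible-avoiding (transpose x) (λ a b → a ≡ x × b ≡ suc x) t inc (transpose-mono x)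
    (λ { h (refl , refl) → noEdge h }) (λ { s (refl , refl) → noSib s })

module Transposition (N x : ℕ) (2≤x : 2 ≤ x) (1+x<N : suc x < N) where

  τ : ℕ → ℕ
  τ = transpose x

  relabelling : Relabelling N τ
  relabelling = record
    { fixes-1 = transpose-< x 1 2≤x
    ; fixes-N = transpose-> x N 1+x<N
    ; permutes = transpose-range x N (≤-trans (s≤s z≤n) 2≤x) (<⇒≤ 1+x<N) }

  relabel-τ-HasChild : ∀ {t p c} → HasChild (relabel τ t) p c → HasChild t (τ p) (τ c)
  relabel-τ-HasChild {t} h =
    subst (λ u → HasChild u _ _) (relabel-inverse (transpose-involutive x) t) (relabel-HasChild τ h)

  -- x ends the minimal chain, so it is a leaf
  transpose-A⇒B : ∀ {t} → InClass N x (suc x) t → ¬ Siblings x t →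
    InClass N (suc x) x (relabel τ t) × ¬ HasChild (relabel τ t) x (suc x)
  transpose-A⇒B {t} inT@(cit , e , _) noSib = inτt , noEdge′
    where
    open Facts (facts cit)
    noEdge : ¬ HasChild t x (suc x)
    noEdge = leaf-noChild distinct (subst (λ z → Subtree (leaf z) t) e (eoc-leaf t (IsCIT-NonNil cit)))
    inτt : InClass N (suc x) x (relabel τ t)
    inτt = subst₂ (λ m k → InClass N m k (relabel τ t)) (transpose-x x) (transpose-suc x)
      (relabel-InClass relabelling (Compatible-transpose x t increasing noEdge noSib) inT)
    noEdge′ : ¬ HasChild (relabel τ t) x (suc x)
    noEdge′ h = <-asym (n<1+n x)
      (HasChild-< increasing (subst₂ (HasChild t) (transpose-x x) (transpose-suc x) (relabel-τ-HasChild h)))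

  -- the minimal chain would pass through the smaller sibling x
  B-noSiblings : ∀ {t} → InClass N (suc x) x t → ¬ Siblings x t
  B-noSiblings {t} (cit , e , _) (u , a , v , s , inj₁ (ru , rv)) =
    chain-right⇒≮ (Facts.distinct (facts cit)) s (subst (_∈T v) (sym e) (RootLabel⇒∈T rv)) (RootLabel⇒NonNil ru)
      (subst₂ _<_ (sym (RootLabel⇒root≡ ru)) (sym (RootLabel⇒root≡ rv)) (n<1+n x))
  B-noSiblings {t} (cit , e , _) (u , a , v , s , inj₂ (ru , rv)) =
    <-asym (n<1+n x) (subst₂ _<_ (RootLabel⇒root≡ ru) (RootLabel⇒root≡ rv)
      (chain-left⇒< (Facts.distinct (facts cit)) s (subst (_∈T u) (sym e) (RootLabel⇒∈T ru)) (RootLabel⇒NonNil rv)))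

  transpose-B⇒A : ∀ {t} → InClass N (suc x) x t → ¬ HasChild t x (suc x) →
    InClass N x (suc x) (relabel τ t) × ¬ Siblings x (relabel τ t)
  transpose-B⇒A {t} inT@(cit , _ , _) noEdge = inτt , noSib′
    where
    inτt : InClass N x (suc x) (relabel τ t)
    inτt = subst₂ (λ m k → InClass N m k (relabel τ t)) (transpose-suc x) (transpose-x x)
      (relabel-InClass relabelling
        (Compatible-transpose x t (Facts.increasing (facts cit)) noEdge (B-noSiblings inT)) inT)
    noSib′ : ¬ Siblings x (relabel τ t)
    noSib′ s =
      B-noSiblings inT (subst (Siblings x) (relabel-inverse (transpose-involutive x) t) (Siblings-transpose x s))

-- Modifying a tree at the parent of a label

true≢false : true ≢ false
true≢false ()

rootIs : ℕ → Tree → Bool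
rootIs x nil = false
rootIs x (node _ a _) = a ≡ᵇ x

hasChildᵇ : ℕ → Tree → Bool
hasChildᵇ x nil = false
hasChildᵇ x (node l _ r) = rootIs x l ∨ rootIs x r

memberᵇ : ℕ → Tree → Bool
memberᵇ x u = ⌊ x ∈? labels u ⌋

atParent : ℕ → (Tree → Tree) → Tree → Tree
atParent x g nil = nil
atParent x g (node l a r) =
  if hasChildᵇ x (node l a r) then g (node l a r)
  else (if memberᵇ x l then node (atParent x g l) a r else node l a (atParent x g r))

-- The run of atParent x on t, ending at the subtree s where g is applied.
data ParentNode (x : ℕ) (s : Tree) : Tree → Set where
  found   : ∀ {l a r} → s ≡ node l a r → hasChildᵇ x (node l a r) ≡ true → ParentNode x s (node l a r)
  goLeft  : ∀ {l a r} → hasChildᵇ x (node l a r) ≡ false → memberᵇ x l ≡ true →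
            ParentNode x s l → ParentNode x s (node l a r)
  goRight : ∀ {l a r} → hasChildᵇ x (node l a r) ≡ false → memberᵇ x l ≡ false →
            ParentNode x s r → ParentNode x s (node l a r)

atParent-found : ∀ {x g u} → hasChildᵇ x u ≡ true → atParent x g u ≡ g u
atParent-found {u = node l a r} c rewrite c = refl

ParentNode-Subtree : ∀ {x s t} → ParentNode x s t → Subtree s t
ParentNode-Subtree (found refl _) = subH
ParentNode-Subtree (goLeft _ _ p) = subL (ParentNode-Subtree p)
ParentNode-Subtree (goRight _ _ p) = subR (ParentNode-Subtree p)

ParentNode-NonNil : ∀ {x s t} → ParentNode x s t → NonNil t
ParentNode-NonNil (found _ _) = tt
ParentNode-NonNil (goLeft _ _ _) = tt
ParentNode-NonNil (goRight _ _ _) = tt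

memberᵇ-true : ∀ {x u} → x ∈T u → memberᵇ x u ≡ true
memberᵇ-true {x} {u} p with x ∈? labels u
... | yes _ = refl
... | no x∉ = ⊥-elim (x∉ (∈T⇒∈ p))

memberᵇ⇒∈T : ∀ {x u} → memberᵇ x u ≡ true → x ∈T u
memberᵇ⇒∈T {x} {u} e with x ∈? labels u
... | yes q = ∈⇒∈T u q

memberᵇ-↭ : ∀ {x u u'} → labels u ↭ labels u' → memberᵇ x u ≡ memberᵇ x u'
memberᵇ-↭ {x} {u} {u'} p with x ∈? labels u | x ∈? labels u'
... | yes _ | yes _ = refl
... | no _ | no _ = refl
... | yes q | no x∉ = ⊥-elim (x∉ (∈-resp-↭ p q))
... | no x∉ | yes q = ⊥-elim (x∉ (∈-resp-↭ (↭-sym p) q))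

≡ᵇ-refl : ∀ a → (a ≡ᵇ a) ≡ true
≡ᵇ-refl zero = refl
≡ᵇ-refl (suc a) = ≡ᵇ-refl a

≡ᵇ-false : ∀ {a b} → a ≢ b → (a ≡ᵇ b) ≡ false
≡ᵇ-false {a} {b} a≢b with a ≡ᵇ b in e
... | true = ⊥-elim (a≢b (≡ᵇ⇒≡ a b (subst T (sym e) tt)))
... | false = refl

rootIs⇒RootLabel : ∀ {x u} → rootIs x u ≡ true → RootLabel x u
rootIs⇒RootLabel {x} {node _ a _} e = ≡ᵇ⇒≡ a x (subst T (sym e) tt)

RootLabel⇒rootIs : ∀ {x u} → RootLabel x u → rootIs x u ≡ true
RootLabel⇒rootIs {x} {node _ a _} refl = ≡ᵇ-refl a

∉⇒rootIs-false : ∀ {z u} → ¬ (z ∈T u) → rootIs z u ≡ false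
∉⇒rootIs-false {z} {nil} _ = refl
∉⇒rootIs-false {z} {node _ b _} z∉ = ≡ᵇ-false {b} {z} λ { refl → z∉ hereT }

hasChildᵇ-left : ∀ x l a r → RootLabel x l → hasChildᵇ x (node l a r) ≡ true
hasChildᵇ-left x l a r p = cong (_∨ rootIs x r) (RootLabel⇒rootIs p)

hasChildᵇ-right : ∀ x l a r → RootLabel x r → hasChildᵇ x (node l a r) ≡ true
hasChildᵇ-right x l a r p = trans (cong (rootIs x l ∨_) (RootLabel⇒rootIs p)) (∨-zeroʳ (rootIs x l))

hasChildᵇ⇒ChildOf : ∀ {x l a r} → hasChildᵇ x (node l a r) ≡ true → ChildOf x l r
hasChildᵇ⇒ChildOf {x} {l} {a} {r} c with rootIs x l in e
... | true = inj₁ (rootIs⇒RootLabel e)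
... | false = inj₂ (rootIs⇒RootLabel {x} {r} c)

hasChildᵇ-ParentNode : ∀ {x s t} → ParentNode x s t → hasChildᵇ x s ≡ true
hasChildᵇ-ParentNode (found refl c) = c
hasChildᵇ-ParentNode (goLeft _ _ p) = hasChildᵇ-ParentNode p
hasChildᵇ-ParentNode (goRight _ _ p) = hasChildᵇ-ParentNode p

ParentNode-ChildOf : ∀ {x s t} → ParentNode x s t →
  Σ Tree λ l → Σ ℕ λ q → Σ Tree λ r → s ≡ node l q r × ChildOf x l r
ParentNode-ChildOf (found {l} {a} {r} e c) = l , a , r , e , hasChildᵇ⇒ChildOf {a = a} c
ParentNode-ChildOf (goLeft _ _ p) = ParentNode-ChildOf p
ParentNode-ChildOf (goRight _ _ p) = ParentNode-ChildOf p

ParentNode-∈T : ∀ {x s t} → ParentNode x s t → x ∈T s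
ParentNode-∈T p with ParentNode-ChildOf p
... | l , q , r , refl , co = ChildOf-∈T co

non-child-root : ∀ {x u w} → hasChildᵇ x w ≡ false → (RootLabel x u → hasChildᵇ x w ≡ true) →
  x ∈T u → root u ≢ x
non-child-root {u = node _ _ _} c child _ e = true≢false (trans (sym (child e)) c)

ParentNode-exists : ∀ x t → x ∈T t → root t ≢ x → Σ Tree λ s → ParentNode x s t
ParentNode-exists x nil () _
ParentNode-exists x (node l a r) x∈ x≢root with hasChildᵇ x (node l a r) in c
... | true = node l a r , found refl c
... | false with memberᵇ x l in m
...   | true =
  let (s , p) = ParentNode-exists x l x∈l (non-child-root {u = l} {node l a r} c (hasChildᵇ-left x l a r) x∈l)
  in s , goLeft c m p
  where x∈l = memberᵇ⇒∈T m
...   | false =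
  let (s , p) = ParentNode-exists x r (inRight x∈)
                  (non-child-root {u = r} {node l a r} c (hasChildᵇ-right x l a r) (inRight x∈))
  in s , goRight c m p
  where
  inRight : x ∈T node l a r → x ∈T r
  inRight hereT = ⊥-elim (x≢root refl)
  inRight (inl q) = ⊥-elim (true≢false (trans (sym (memberᵇ-true q)) m))
  inRight (inr q) = q

Subtree⇒ParentNode : ∀ {x t l q r} → Distinct t → Increasing t → Subtree (node l q r) t → ChildOf x l r →
  root t ≢ x → ParentNode x (node l q r) t
Subtree⇒ParentNode {x} {t} d i s co x≢root with ParentNode-exists x t (Subtree-∈T s (ChildOf-∈T co)) x≢root
... | _ , p with ParentNode-ChildOf p
... | _ , _ , _ , refl , co₀ with parent-node-unique d i (ParentNode-Subtree p) co₀ s co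
... | refl = p

data RightSpine (s : Tree) : Tree → Set where
  spine-here  : RightSpine s s
  spine-right : ∀ {l a r} → RightSpine s r → RightSpine s (node l a r)

RightSpine-Subtree : ∀ {s t} → RightSpine s t → Subtree s t
RightSpine-Subtree spine-here = subH
RightSpine-Subtree (spine-right p) = subR (RightSpine-Subtree p)

RightSpine-trans : ∀ {s u t} → RightSpine s u → RightSpine u t → RightSpine s t
RightSpine-trans p spine-here = p
RightSpine-trans p (spine-right q) = spine-right (RightSpine-trans p q)

relabel-RightSpine : ∀ f {s t} → RightSpine s t → RightSpine (relabel f s) (relabel f t)
relabel-RightSpine f spine-here = spine-here
relabel-RightSpine f (spine-right p) = spine-right (relabel-RightSpine f p)

RightSpine-RightmostException : ∀ {s t} → NonNil s → RightSpine s t → RightmostException t →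
  RightmostException s
RightSpine-RightmostException n spine-here re = re
RightSpine-RightmostException n (spine-right {r = node _ _ _} p) (_ , _ , re) =
  RightSpine-RightmostException n p re
RightSpine-RightmostException {node _ _ _} n (spine-right {r = nil} ()) re

size : Tree → ℕ
size nil = 0
size (node l a r) = suc (size l + size r)

RightSpine-size : ∀ {s t} → RightSpine s t → size s ≤ size t
RightSpine-size spine-here = ≤-refl
RightSpine-size (spine-right {l} p) = ≤-trans (RightSpine-size p) (≤-trans (m≤n+m _ (size l)) (n≤1+n _))

RightSpine-parent : ∀ {u t} → RightSpine u t → u ≢ t → Σ Tree λ L → Σ ℕ λ q → RightSpine (node L q u) t
RightSpine-parent spine-here u≢t = ⊥-elim (u≢t refl)
RightSpine-parent (spine-right {l} {a} spine-here) _ = l , a , spine-here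
RightSpine-parent {u} (spine-right {l} {a} (spine-right {l'} {a'} {r'} p)) _ =
  let (L , q , sp) = RightSpine-parent (spine-right p) u≢r in L , q , spine-right sp
  where
  u≢r : u ≢ node l' a' r'
  u≢r refl = 1+n≰n (≤-trans (s≤s (m≤n+m _ (size l'))) (RightSpine-size p))

onSpine : ∀ {x s t} → ParentNode x s t → Bool
onSpine (found _ _) = true
onSpine (goLeft _ _ _) = false
onSpine (goRight _ _ p) = onSpine p

RightSpine⇒onSpine : ∀ {x s t} → Distinct t → (p : ParentNode x s t) → RightSpine s t → onSpine p ≡ true
RightSpine⇒onSpine d (found refl c) sp = refl
RightSpine⇒onSpine d (goLeft c m p) spine-here =
  ⊥-elim (true≢false (trans (sym (hasChildᵇ-ParentNode p)) c))
RightSpine⇒onSpine (_ , _ , dj , _) (goLeft c m p) (spine-right sp) =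
  ⊥-elim (dj (memberᵇ⇒∈T m) (Subtree-∈T (RightSpine-Subtree sp) (ParentNode-∈T p)))
RightSpine⇒onSpine d (goRight c m p) spine-here =
  ⊥-elim (true≢false (trans (sym (hasChildᵇ-ParentNode p)) c))
RightSpine⇒onSpine (_ , _ , _ , _ , dr) (goRight c m p) (spine-right sp) = RightSpine⇒onSpine dr p sp

onSpine⇒RightSpine : ∀ {x s t} → (p : ParentNode x s t) → onSpine p ≡ true → RightSpine s t
onSpine⇒RightSpine (found refl c) _ = spine-here
onSpine⇒RightSpine (goLeft c m p) ()
onSpine⇒RightSpine (goRight c m p) e = spine-right (onSpine⇒RightSpine p e)

RightSpine⇒ParentNode : ∀ {N y t l q r} → 2 ≤ y → IsCIT N t → ChildOf y l r → RightSpine (node l q r) t →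
  Σ (ParentNode y (node l q r) t) λ p → onSpine p ≡ true
RightSpine⇒ParentNode {N} {y} {t} 2≤y cit co sp = p , RightSpine⇒onSpine distinct p sp
  where
  open Facts (facts cit)
  root≢y : root t ≢ y
  root≢y e = <-irrefl (trans (sym (RootLabel⇒root≡ rootLabel)) e) 2≤y
  p = Subtree⇒ParentNode distinct increasing (RightSpine-Subtree sp) co root≢y

locateParent : ℕ → Tree → Tree × Bool
locateParent x nil = nil , false
locateParent x (node l a r) =
  if hasChildᵇ x (node l a r) then (node l a r , true)
  else (if memberᵇ x l then (proj₁ (locateParent x l) , false) else locateParent x r)

locateParent-found : ∀ {x u} → hasChildᵇ x u ≡ true → locateParent x u ≡ (u , true)
locateParent-found {u = node l a r} c rewrite c = refl

locateParent-ParentNode : ∀ {x s t} → (p : ParentNode x s t) → locateParent x t ≡ (s , onSpine p)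
locateParent-ParentNode (found refl c) rewrite c = refl
locateParent-ParentNode (goLeft c m p) rewrite c | m | locateParent-ParentNode p = refl
locateParent-ParentNode (goRight c m p) rewrite c | m | locateParent-ParentNode p = refl

ZeroOrTwo-resp-NonNilˡ : ∀ {l l' r} → NonNil l' → NonNil l → ZeroOrTwo l r → ZeroOrTwo l' r
ZeroOrTwo-resp-NonNilˡ {node _ _ _} {node _ _ _} _ _ (inj₂ (_ , nr)) = inj₂ (tt , nr)

ZeroOrTwo-resp-NonNilʳ : ∀ {l r r'} → NonNil r' → NonNil r → ZeroOrTwo l r → ZeroOrTwo l r'
ZeroOrTwo-resp-NonNilʳ {l} {node _ _ _} {node _ _ _} _ _ (inj₂ (nl , _)) = inj₂ (nl , tt)

Above-resp-root : ∀ {a u u'} → root u' ≡ root u → NonNil u' → NonNil u → Above a u → Above a u'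
Above-resp-root {u = node _ _ _} {node _ _ _} e _ _ p = subst (_ <_) (sym e) p

rootIs-resp-root : ∀ {x u u'} → NonNil u → NonNil u' → root u ≡ root u' → rootIs x u ≡ rootIs x u'
rootIs-resp-root {x} {node _ a _} {node _ b _} _ _ e = cong (_≡ᵇ x) e

RightmostException-node : ∀ {l a r} → NonNil r → NonNil l → AllZeroOrTwo l → RightmostException r →
  RightmostException (node l a r)
RightmostException-node {r = node _ _ _} _ n az re = n , az , re

module AtParent (x : ℕ) (g : Tree → Tree) where

  record Replacement (s : Tree) : Set where
    field
      root-≡    : root (g s) ≡ root s
      nonNil    : NonNil (g s)
      labels-↭ : labels (g s) ↭ labels s

  module _ {s} (ρ : Replacement s) where
    open Replacement ρ

    labels-atParent : ∀ {t} → ParentNode x s t → labels (atParent x g t) ↭ labels t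
    labels-atParent (found refl c) rewrite c = labels-↭
    labels-atParent {node l a r} (goLeft c m p) rewrite c | m = Perm.++⁺ʳ (a ∷ labels r) (labels-atParent p)
    labels-atParent {node l a r} (goRight c m p) rewrite c | m =
      Perm.++⁺ˡ (labels l) (prep a (labels-atParent p))

    root-atParent : ∀ {t} → ParentNode x s t → root (atParent x g t) ≡ root t
    root-atParent (found refl c) rewrite c = root-≡
    root-atParent (goLeft c m p) rewrite c | m = refl
    root-atParent (goRight c m p) rewrite c | m = refl

    NonNil-atParent : ∀ {t} → ParentNode x s t → NonNil (atParent x g t)
    NonNil-atParent (found refl c) rewrite c = nonNil
    NonNil-atParent (goLeft c m p) rewrite c | m = tt
    NonNil-atParent (goRight c m p) rewrite c | m = tt

    RootLabel-atParent : ∀ {t y} → ParentNode x s t → RootLabel y t → RootLabel y (atParent x g t)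
    RootLabel-atParent {t} p r with atParent x g t | root-atParent p | NonNil-atParent p
    ... | node _ _ _ | e | _ = trans e (RootLabel⇒root≡ r)

    Increasing-atParent : ∀ {t} → ParentNode x s t → Increasing (g s) → Increasing t →
      Increasing (atParent x g t)
    Increasing-atParent (found refl c) i it rewrite c = i
    Increasing-atParent {node l a r} (goLeft c m p) i (al , ar , il , ir) rewrite c | m =
      Above-resp-root (root-atParent p) (NonNil-atParent p) (ParentNode-NonNil p) al , ar ,
      Increasing-atParent p i il , ir
    Increasing-atParent {node l a r} (goRight c m p) i (al , ar , il , ir) rewrite c | m =
      al , Above-resp-root (root-atParent p) (NonNil-atParent p) (ParentNode-NonNil p) ar ,
      il , Increasing-atParent p i ir

    AllZeroOrTwo-atParent : ∀ {t} → ParentNode x s t → (AllZeroOrTwo s → AllZeroOrTwo (g s)) →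
      AllZeroOrTwo t → AllZeroOrTwo (atParent x g t)
    AllZeroOrTwo-atParent (found refl c) h az rewrite c = h az
    AllZeroOrTwo-atParent {node l a r} (goLeft c m p) h (z , al , ar) rewrite c | m =
      ZeroOrTwo-resp-NonNilˡ (NonNil-atParent p) (ParentNode-NonNil p) z , AllZeroOrTwo-atParent p h al , ar
    AllZeroOrTwo-atParent {node l a r} (goRight c m p) h (z , al , ar) rewrite c | m =
      ZeroOrTwo-resp-NonNilʳ (NonNil-atParent p) (ParentNode-NonNil p) z , al , AllZeroOrTwo-atParent p h ar

    RightmostException-atParent : ∀ {t} → ParentNode x s t → (AllZeroOrTwo s → AllZeroOrTwo (g s)) →
      (RightSpine s t → RightmostException s → RightmostException (g s)) →
      RightmostException t → RightmostException (atParent x g t)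
    RightmostException-atParent (found refl c) _ hr re rewrite c = hr spine-here re
    RightmostException-atParent {node l a nil} (goLeft c m p) ha _ (_ , az) rewrite c | m =
      NonNil-atParent p , AllZeroOrTwo-atParent p ha az
    RightmostException-atParent {node l a (node _ _ _)} (goLeft c m p) ha _ (_ , az , re) rewrite c | m =
      NonNil-atParent p , AllZeroOrTwo-atParent p ha az , re
    RightmostException-atParent {node l a nil} (goRight c m ()) _ _ _
    RightmostException-atParent {node l a (node _ _ _)} (goRight c m p) ha hr (n , az , re) rewrite c | m =
      RightmostException-node (NonNil-atParent p) n az (RightmostException-atParent p ha (hr ∘ spine-right) re)

    Subtree-atParent : ∀ {t} → ParentNode x s t → Subtree (g s) (atParent x g t)
    Subtree-atParent (found refl c) rewrite c = subH
    Subtree-atParent (goLeft c m p) rewrite c | m = subL (Subtree-atParent p)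
    Subtree-atParent (goRight c m p) rewrite c | m = subR (Subtree-atParent p)

    RightSpine-atParent : ∀ {t} → (p : ParentNode x s t) → onSpine p ≡ true → RightSpine (g s) (atParent x g t)
    RightSpine-atParent (found refl c) e rewrite c = spine-here
    RightSpine-atParent (goLeft c m p) ()
    RightSpine-atParent (goRight c m p) e rewrite c | m = spine-right (RightSpine-atParent p e)

    eoc-atParent : ∀ {t} → Distinct t → ParentNode x s t → eoc t ∈T s → eoc (atParent x g t) ≡ eoc (g s)
    eoc-atParent d (found refl c) q rewrite c = refl
    eoc-atParent {node l a r} d (goLeft c m p) q rewrite c | m =
      trans (eoc-replace-left d q' (atParent x g l) (root-atParent p) (NonNil-atParent p))
            (eoc-atParent (proj₁ (proj₂ (proj₂ (proj₂ d)))) p (subst (_∈T s) (eoc-Subtree d (subL subH) q') q))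
      where q' = Subtree-∈T (ParentNode-Subtree p) q
    eoc-atParent {node l a r} d (goRight c m p) q rewrite c | m =
      trans (eoc-replace-right d q' (atParent x g r) (root-atParent p) (NonNil-atParent p))
            (eoc-atParent (proj₂ (proj₂ (proj₂ (proj₂ d)))) p (subst (_∈T s) (eoc-Subtree d (subR subH) q') q))
      where q' = Subtree-∈T (ParentNode-Subtree p) q

    module _ (g-hasChild : hasChildᵇ x (g s) ≡ true) where

      private
        hasChildᵇ-left′ : ∀ {l a r} → ParentNode x s l → hasChildᵇ x (node l a r) ≡ false →
          hasChildᵇ x (node (atParent x g l) a r) ≡ false
        hasChildᵇ-left′ {l} {a} {r} p c =
          trans (cong (_∨ rootIs x r) (rootIs-resp-root (NonNil-atParent p) (ParentNode-NonNil p) (root-atParent p))) c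
        hasChildᵇ-right′ : ∀ {l a r} → ParentNode x s r → hasChildᵇ x (node l a r) ≡ false →
          hasChildᵇ x (node l a (atParent x g r)) ≡ false
        hasChildᵇ-right′ {l} {a} {r} p c =
          trans (cong (rootIs x l ∨_) (rootIs-resp-root (NonNil-atParent p) (ParentNode-NonNil p) (root-atParent p))) c

      locateParent-atParent : ∀ {t} → (p : ParentNode x s t) →
        locateParent x (atParent x g t) ≡ (g s , onSpine p)
      locateParent-atParent (found refl c) rewrite c = locateParent-found g-hasChild
      locateParent-atParent {node l a r} (goLeft c m p) rewrite c | m
        | hasChildᵇ-left′ {l} {a} {r} p c | trans (memberᵇ-↭ {x} {atParent x g l} {l} (labels-atParent p)) m
        | locateParent-atParent p = refl
      locateParent-atParent {node l a r} (goRight c m p) rewrite c | m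
        | hasChildᵇ-right′ {l} {a} {r} p c | m
        | locateParent-atParent p = refl

      atParent-inverse : ∀ g' {t} → ParentNode x s t → g' (g s) ≡ s → atParent x g' (atParent x g t) ≡ t
      atParent-inverse g' (found refl c) inv rewrite c =
        trans (atParent-found {x} {g'} {g (node _ _ _)} g-hasChild) inv
      atParent-inverse g' {node l a r} (goLeft c m p) inv rewrite c | m
        | hasChildᵇ-left′ {l} {a} {r} p c | trans (memberᵇ-↭ {x} {atParent x g l} {l} (labels-atParent p)) m
        = cong (λ u → node u a r) (atParent-inverse g' p inv)
      atParent-inverse g' {node l a r} (goRight c m p) inv rewrite c | m
        | hasChildᵇ-right′ {l} {a} {r} p c | m
        = cong (λ u → node l a u) (atParent-inverse g' p inv)

  record Admissible {s t} (p : ParentNode x s t) (s' : Tree) : Set where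
    field
      result       : g s ≡ s'
      root-≡       : root s' ≡ root s
      nonNil       : NonNil s'
      labels-↭    : labels s' ↭ labels s
      increasing   : Increasing s'
      allZeroOrTwo : AllZeroOrTwo s → AllZeroOrTwo s'
      rightmost    : RightSpine s t → RightmostException s → RightmostException s'

    replacement : Replacement s
    replacement = record
      { root-≡ = trans (cong root result) root-≡
      ; nonNil = subst NonNil (sym result) nonNil
      ; labels-↭ = subst (λ u → labels u ↭ labels s) (sym result) labels-↭ }

  atParent-IsCIT : ∀ {N s s' t} {p : ParentNode x s t} → Admissible p s' → N % 2 ≡ 0 →
    IsCIT N t → IsCIT N (atParent x g t)
  atParent-IsCIT {N} {p = p} α even ((perm , r1 , inc) , complete) =
    (Perm.trans (labels-atParent ρ p) perm , RootLabel-atParent ρ p r1 ,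
     Increasing-atParent ρ p (subst Increasing (sym result) increasing) inc) ,
    inj₁ (even , RightmostException-atParent ρ p (subst AllZeroOrTwo (sym result) ∘ allZeroOrTwo)
                   (λ sp → subst RightmostException (sym result) ∘ rightmost sp)
                   (even-RightmostException {N} even complete))
    where
    open Admissible α
    ρ = replacement

  atParent-InClass : ∀ {N m k m' k' s s' t} {p : ParentNode x s t} → Admissible p s' → N % 2 ≡ 0 →
    InClass N m k t → eoc t ∈T s → eoc s' ≡ m' → HasChild s' k' N → InClass N m' k' (atParent x g t)
  atParent-InClass {p = p} α even (cit , e , _) eoc∈ eoc-s' pom-s' =
    atParent-IsCIT α even cit ,
    trans (eoc-atParent replacement (Facts.distinct (facts cit)) p eoc∈) (trans (cong eoc result) eoc-s') ,
    HasChild-Subtree (Subtree-atParent replacement p) (subst (λ u → HasChild u _ _) (sym result) pom-s')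
    where open Admissible α

-- Cherries and siblings

_≟T_ : (u v : Tree) → Dec (u ≡ v)
nil ≟T nil = yes refl
nil ≟T node _ _ _ = no λ ()
node _ _ _ ≟T nil = no λ ()
node l a r ≟T node l' a' r' with l ≟T l' | a ≟ a' | r ≟T r'
... | yes refl | yes refl | yes refl = yes refl
... | no l≢l' | _ | _ = no λ { refl → l≢l' refl }
... | yes _ | no a≢a' | _ = no λ { refl → a≢a' refl }
... | yes _ | yes _ | no r≢r' = no λ { refl → r≢r' refl }

leftOf : Tree → Tree
leftOf nil = nil
leftOf (node l _ _) = l

rightOf : Tree → Tree
rightOf nil = nil
rightOf (node _ _ r) = r

Above-< : ∀ {a b u} → a < b → Above b u → Above a u
Above-< {u = nil} _ _ = tt
Above-< {u = node _ _ _} lt p = <-trans lt p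

Increasing-leaf : ∀ z → Increasing (leaf z)
Increasing-leaf z = tt , tt , tt , tt

AllZeroOrTwo-leaf : ∀ z → AllZeroOrTwo (leaf z)
AllZeroOrTwo-leaf z = inj₁ (refl , refl) , tt , tt

-- The moves act at the parent q of x, with N the largest label: in withCherry the cherry x(x+1, N)
-- hangs from q next to a subtree Y, in withSiblings the leaf x hangs from q next to x+1, which carries
-- N and Y. The Bool arguments choose between left and right at each node.
module Cherry (x N : ℕ) (1+x<N : suc x < N) where

  x<N : x < N
  x<N = <-trans (n<1+n x) 1+x<N

  cherry : Bool → Tree
  cherry true = node (leaf (suc x)) x (leaf N)
  cherry false = node (leaf N) x (leaf (suc x))

  fork : Bool → Tree → Tree
  fork true Y = node (leaf N) (suc x) Y
  fork false Y = node Y (suc x) (leaf N)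

  withCherry : Bool → Bool → ℕ → Tree → Tree
  withCherry true o q Y = node (cherry o) q Y
  withCherry false o q Y = node Y q (cherry o)

  withSiblings : Bool → Bool → ℕ → Tree → Tree
  withSiblings true o q Y = node (leaf x) q (fork o Y)
  withSiblings false o q Y = node (fork o Y) q (leaf x)

  forkOf : Tree → Tree → Tree
  forkOf A Y = if rootIs (suc x) A then fork true Y else fork false Y

  cherry⇒siblings : Tree → Tree
  cherry⇒siblings nil = nil
  cherry⇒siblings (node l q r) =
    if rootIs x l then node (leaf x) q (forkOf (leftOf l) r) else node (forkOf (leftOf r) l) q (leaf x)

  cherryFrom : Bool → ℕ → Tree → Tree
  cherryFrom side q nil = nil
  cherryFrom side q (node A _ B) = if rootIs N A then withCherry side true q B else withCherry side false q A

  siblings⇒cherry : Tree → Tree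
  siblings⇒cherry nil = nil
  siblings⇒cherry (node l q r) = if rootIs x l then cherryFrom true q r else cherryFrom false q l

  private
    N≢ᵇ1+x : (N ≡ᵇ suc x) ≡ false
    N≢ᵇ1+x = ≡ᵇ-false (≢-sym (<⇒≢ 1+x<N))
    1+x≢ᵇx : (suc x ≡ᵇ x) ≡ false
    1+x≢ᵇx = ≡ᵇ-false (≢-sym (<⇒≢ (n<1+n x)))

  cherry⇒siblings-withCherry : ∀ side o q Y → rootIs x Y ≡ false →
    cherry⇒siblings (withCherry side o q Y) ≡ withSiblings side o q Y
  cherry⇒siblings-withCherry true true q Y hx rewrite ≡ᵇ-refl x = refl
  cherry⇒siblings-withCherry true false q Y hx rewrite ≡ᵇ-refl x | N≢ᵇ1+x = refl
  cherry⇒siblings-withCherry false true q Y hx rewrite hx | ≡ᵇ-refl (suc x) = refl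
  cherry⇒siblings-withCherry false false q Y hx rewrite hx | N≢ᵇ1+x = refl

  siblings⇒cherry-withSiblings : ∀ side o q Y → rootIs N Y ≡ false →
    siblings⇒cherry (withSiblings side o q Y) ≡ withCherry side o q Y
  siblings⇒cherry-withSiblings true true q Y hN rewrite ≡ᵇ-refl x | ≡ᵇ-refl N = refl
  siblings⇒cherry-withSiblings true false q Y hN rewrite ≡ᵇ-refl x | hN = refl
  siblings⇒cherry-withSiblings false true q Y hN rewrite 1+x≢ᵇx | ≡ᵇ-refl N = refl
  siblings⇒cherry-withSiblings false false q Y hN rewrite 1+x≢ᵇx | hN = refl

  hasChildᵇ-withCherry : ∀ side o q Y → hasChildᵇ x (withCherry side o q Y) ≡ true
  hasChildᵇ-withCherry true o q Y = hasChildᵇ-left x (cherry o) q Y (chroot o)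
    where
    chroot : ∀ o → RootLabel x (cherry o)
    chroot true = refl
    chroot false = refl
  hasChildᵇ-withCherry false o q Y = hasChildᵇ-right x Y q (cherry o) (chroot o)
    where
    chroot : ∀ o → RootLabel x (cherry o)
    chroot true = refl
    chroot false = refl

  hasChildᵇ-withSiblings : ∀ side o q Y → hasChildᵇ x (withSiblings side o q Y) ≡ true
  hasChildᵇ-withSiblings true o q Y = hasChildᵇ-left x (leaf x) q (fork o Y) refl
  hasChildᵇ-withSiblings false o q Y = hasChildᵇ-right x (fork o Y) q (leaf x) refl

  root-withCherry : ∀ side o q Y → root (withCherry side o q Y) ≡ q
  root-withCherry true o q Y = refl
  root-withCherry false o q Y = refl

  root-withSiblings : ∀ side o q Y → root (withSiblings side o q Y) ≡ q
  root-withSiblings true o q Y = refl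
  root-withSiblings false o q Y = refl

  private
    moveBack : ∀ (a b c d : ℕ) LY → a ∷ b ∷ c ∷ d ∷ LY ↭ LY ++ a ∷ b ∷ c ∷ d ∷ []
    moveBack a b c d LY = Perm.++-comm (a ∷ b ∷ c ∷ d ∷ []) LY

  labels-withCherry : ∀ side o q Y → labels (withCherry side o q Y) ↭ labels Y ++ q ∷ labels (cherry o)
  labels-withCherry true o q Y =
    Perm.trans (Perm.++-comm (labels (cherry o)) (q ∷ labels Y)) (↭-sym (Perm.shift q (labels Y) (labels (cherry o))))
  labels-withCherry false o q Y = Perm.refl

  labels-withSiblings : ∀ side o q Y → labels (withSiblings side o q Y) ↭ labels Y ++ q ∷ x ∷ suc x ∷ N ∷ []
  labels-withSiblings true true q Y = Perm.trans (moveBack x q N (suc x) (labels Y)) (Perm.++⁺ˡ (labels Y)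
    (Perm.trans (swap x q Perm.refl) (prep q (prep x (swap N (suc x) Perm.refl)))))
  labels-withSiblings true false q Y = Perm.trans (prep x (prep q (Perm.++-comm (labels Y) (suc x ∷ N ∷ []))))
    (Perm.trans (moveBack x q (suc x) N (labels Y)) (Perm.++⁺ˡ (labels Y) (swap x q Perm.refl)))
  labels-withSiblings false true q Y = Perm.trans (Perm.++-comm (N ∷ suc x ∷ labels Y) (q ∷ x ∷ []))
    (Perm.trans (moveBack q x N (suc x) (labels Y)) (Perm.++⁺ˡ (labels Y) (prep q (prep x (swap N (suc x) Perm.refl)))))
  labels-withSiblings false false q Y = Perm.trans (Perm.++-assoc (labels Y) (suc x ∷ N ∷ []) (q ∷ x ∷ []))
    (Perm.++⁺ˡ (labels Y) (Perm.trans (prep (suc x) (swap N q Perm.refl)) (Perm.trans (swap (suc x) q Perm.refl)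
      (Perm.trans (prep q (prep (suc x) (swap N x Perm.refl))) (prep q (swap (suc x) x Perm.refl))))))

  labels-cherry : ∀ o → labels (cherry o) ↭ x ∷ suc x ∷ N ∷ []
  labels-cherry true = swap (suc x) x Perm.refl
  labels-cherry false = Perm.trans (swap N x Perm.refl) (prep x (swap N (suc x) Perm.refl))

  labels-withSiblings-withCherry : ∀ side o q Y →
    labels (withSiblings side o q Y) ↭ labels (withCherry side o q Y)
  labels-withSiblings-withCherry side o q Y = Perm.trans (labels-withSiblings side o q Y)
    (↭-sym (Perm.trans (labels-withCherry side o q Y) (Perm.++⁺ˡ (labels Y) (prep q (labels-cherry o)))))

  Increasing-cherry : ∀ o → Increasing (cherry o)
  Increasing-cherry true = n<1+n x , x<N , Increasing-leaf (suc x) , Increasing-leaf N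
  Increasing-cherry false = x<N , n<1+n x , Increasing-leaf N , Increasing-leaf (suc x)

  Increasing-fork : ∀ o Y → Above (suc x) Y → Increasing Y → Increasing (fork o Y)
  Increasing-fork true Y a i = 1+x<N , a , Increasing-leaf N , i
  Increasing-fork false Y a i = a , 1+x<N , i , Increasing-leaf N

  Increasing-withCherry⇒withSiblings : ∀ side o q Y → Increasing (withCherry side o q Y) → Above (suc x) Y →
    Increasing (withSiblings side o q Y)
  Increasing-withCherry⇒withSiblings true true q Y (qx , _ , _ , iY) a =
    qx , <-trans qx (n<1+n x) , Increasing-leaf x , Increasing-fork true Y a iY
  Increasing-withCherry⇒withSiblings true false q Y (qx , _ , _ , iY) a =
    qx , <-trans qx (n<1+n x) , Increasing-leaf x , Increasing-fork false Y a iY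
  Increasing-withCherry⇒withSiblings false true q Y (_ , qx , iY , _) a =
    <-trans qx (n<1+n x) , qx , Increasing-fork true Y a iY , Increasing-leaf x
  Increasing-withCherry⇒withSiblings false false q Y (_ , qx , iY , _) a =
    <-trans qx (n<1+n x) , qx , Increasing-fork false Y a iY , Increasing-leaf x

  Increasing-withSiblings⇒withCherry : ∀ side o q Y → Increasing (withSiblings side o q Y) →
    Increasing (withCherry side o q Y) × Above (suc x) Y
  Increasing-withSiblings⇒withCherry true true q Y (qx , qsx , _ , (_ , a , _ , iY)) =
    (qx , Above-< qsx a , Increasing-cherry true , iY) , a
  Increasing-withSiblings⇒withCherry true false q Y (qx , qsx , _ , (a , _ , iY , _)) =
    (qx , Above-< qsx a , Increasing-cherry false , iY) , a
  Increasing-withSiblings⇒withCherry false true q Y (qsx , qx , (_ , a , _ , iY) , _) =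
    (Above-< qsx a , qx , iY , Increasing-cherry true) , a
  Increasing-withSiblings⇒withCherry false false q Y (qsx , qx , (a , _ , iY , _) , _) =
    (Above-< qsx a , qx , iY , Increasing-cherry false) , a

  AllZeroOrTwo-cherry : ∀ o → AllZeroOrTwo (cherry o)
  AllZeroOrTwo-cherry true = inj₂ (tt , tt) , AllZeroOrTwo-leaf (suc x) , AllZeroOrTwo-leaf N
  AllZeroOrTwo-cherry false = inj₂ (tt , tt) , AllZeroOrTwo-leaf N , AllZeroOrTwo-leaf (suc x)

  AllZeroOrTwo-withCherry⇒withSiblings : ∀ side o q Y → AllZeroOrTwo (withCherry side o q Y) →
    AllZeroOrTwo (withSiblings side o q Y)
  AllZeroOrTwo-withCherry⇒withSiblings true true q (node _ _ _) (_ , _ , aY) =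
    inj₂ (tt , tt) , AllZeroOrTwo-leaf x , (inj₂ (tt , tt) , AllZeroOrTwo-leaf N , aY)
  AllZeroOrTwo-withCherry⇒withSiblings true false q (node _ _ _) (_ , _ , aY) =
    inj₂ (tt , tt) , AllZeroOrTwo-leaf x , (inj₂ (tt , tt) , aY , AllZeroOrTwo-leaf N)
  AllZeroOrTwo-withCherry⇒withSiblings false true q (node _ _ _) (_ , aY , _) =
    inj₂ (tt , tt) , (inj₂ (tt , tt) , AllZeroOrTwo-leaf N , aY) , AllZeroOrTwo-leaf x
  AllZeroOrTwo-withCherry⇒withSiblings false false q (node _ _ _) (_ , aY , _) =
    inj₂ (tt , tt) , (inj₂ (tt , tt) , aY , AllZeroOrTwo-leaf N) , AllZeroOrTwo-leaf x
  AllZeroOrTwo-withCherry⇒withSiblings true true q nil (inj₁ (() , _) , _)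
  AllZeroOrTwo-withCherry⇒withSiblings true true q nil (inj₂ (_ , ()) , _)
  AllZeroOrTwo-withCherry⇒withSiblings true false q nil (inj₁ (() , _) , _)
  AllZeroOrTwo-withCherry⇒withSiblings true false q nil (inj₂ (_ , ()) , _)
  AllZeroOrTwo-withCherry⇒withSiblings false true q nil (inj₁ (_ , ()) , _)
  AllZeroOrTwo-withCherry⇒withSiblings false true q nil (inj₂ (() , _) , _)
  AllZeroOrTwo-withCherry⇒withSiblings false false q nil (inj₁ (_ , ()) , _)
  AllZeroOrTwo-withCherry⇒withSiblings false false q nil (inj₂ (() , _) , _)

  AllZeroOrTwo-withSiblings⇒withCherry : ∀ side o q Y → AllZeroOrTwo (withSiblings side o q Y) →
    AllZeroOrTwo (withCherry side o q Y)
  AllZeroOrTwo-withSiblings⇒withCherry true true q (node _ _ _) (_ , _ , (_ , _ , aY)) =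
    inj₂ (tt , tt) , AllZeroOrTwo-cherry true , aY
  AllZeroOrTwo-withSiblings⇒withCherry true false q (node _ _ _) (_ , _ , (_ , aY , _)) =
    inj₂ (tt , tt) , AllZeroOrTwo-cherry false , aY
  AllZeroOrTwo-withSiblings⇒withCherry false true q (node _ _ _) (_ , (_ , _ , aY) , _) =
    inj₂ (tt , tt) , aY , AllZeroOrTwo-cherry true
  AllZeroOrTwo-withSiblings⇒withCherry false false q (node _ _ _) (_ , (_ , aY , _) , _) =
    inj₂ (tt , tt) , aY , AllZeroOrTwo-cherry false
  AllZeroOrTwo-withSiblings⇒withCherry true true q nil (_ , _ , (inj₁ (() , _) , _))
  AllZeroOrTwo-withSiblings⇒withCherry true true q nil (_ , _ , (inj₂ (_ , ()) , _))
  AllZeroOrTwo-withSiblings⇒withCherry true false q nil (_ , _ , (inj₁ (_ , ()) , _))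
  AllZeroOrTwo-withSiblings⇒withCherry true false q nil (_ , _ , (inj₂ (() , _) , _))
  AllZeroOrTwo-withSiblings⇒withCherry false true q nil (_ , (inj₁ (() , _) , _) , _)
  AllZeroOrTwo-withSiblings⇒withCherry false true q nil (_ , (inj₂ (_ , ()) , _) , _)
  AllZeroOrTwo-withSiblings⇒withCherry false false q nil (_ , (inj₁ (_ , ()) , _) , _)
  AllZeroOrTwo-withSiblings⇒withCherry false false q nil (_ , (inj₂ (() , _) , _) , _)

  ¬RightmostException-cherry : ∀ o → ¬ RightmostException (cherry o)
  ¬RightmostException-cherry true (_ , _ , (() , _))
  ¬RightmostException-cherry false (_ , _ , (() , _))

  RightmostException-withCherry-side : ∀ side o q Y → RightmostException (withCherry side o q Y) → side ≡ true
  RightmostException-withCherry-side true o q Y _ = refl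
  RightmostException-withCherry-side false true q nil (() , _)
  RightmostException-withCherry-side false false q nil (() , _)
  RightmostException-withCherry-side false true q (node _ _ _) (_ , _ , re) =
    ⊥-elim (¬RightmostException-cherry true re)
  RightmostException-withCherry-side false false q (node _ _ _) (_ , _ , re) =
    ⊥-elim (¬RightmostException-cherry false re)

  RightmostException-withSiblings-side : ∀ side o q Y → RightmostException (withSiblings side o q Y) →
    side ≡ true × o ≡ true
  RightmostException-withSiblings-side true true q Y _ = refl , refl
  RightmostException-withSiblings-side true false q nil (_ , _ , (_ , _ , (() , _)))
  RightmostException-withSiblings-side true false q (node _ _ _) (_ , _ , (_ , _ , (() , _)))
  RightmostException-withSiblings-side false true q Y (_ , _ , (() , _))
  RightmostException-withSiblings-side false false q Y (_ , _ , (() , _))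

  RightmostException-withCherry⇒withSiblings : ∀ q Y → RightmostException (withCherry true true q Y) →
    RightmostException (withSiblings true true q Y)
  RightmostException-withCherry⇒withSiblings q nil (_ , _) =
    tt , AllZeroOrTwo-leaf x , (tt , AllZeroOrTwo-leaf N)
  RightmostException-withCherry⇒withSiblings q (node _ _ _) (_ , _ , re) =
    tt , AllZeroOrTwo-leaf x , (tt , AllZeroOrTwo-leaf N , re)

  RightmostException-withSiblings⇒withCherry : ∀ q Y → RightmostException (withSiblings true true q Y) →
    RightmostException (withCherry true true q Y)
  RightmostException-withSiblings⇒withCherry q nil _ = tt , AllZeroOrTwo-cherry true
  RightmostException-withSiblings⇒withCherry q (node _ _ _) (_ , _ , (_ , _ , re)) =
    tt , AllZeroOrTwo-cherry true , re

  x∈cherry : ∀ o → x ∈T cherry o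
  x∈cherry true = hereT
  x∈cherry false = hereT
  N∈cherry : ∀ o → N ∈T cherry o
  N∈cherry true = inr hereT
  N∈cherry false = inl hereT
  RootLabel-cherry : ∀ o → RootLabel x (cherry o)
  RootLabel-cherry true = refl
  RootLabel-cherry false = refl
  1+x∈cherry : ∀ o → suc x ∈T cherry o
  1+x∈cherry true = inl hereT
  1+x∈cherry false = inr hereT

  eoc-cherry : ∀ o → eoc (cherry o) ≡ suc x
  eoc-cherry true with eoc-branch nil (suc x) nil x nil N nil
  ... | inj₁ (_ , e) = e
  ... | inj₂ (n , _) = ⊥-elim (n 1+x<N)
  eoc-cherry false with eoc-branch nil N nil x nil (suc x) nil
  ... | inj₁ (lt , _) = ⊥-elim (<-asym lt 1+x<N)
  ... | inj₂ (_ , e) = e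

  eoc-withCherry : ∀ side o q Y → Above (suc x) Y → eoc (withCherry side o q Y) ≡ suc x
  eoc-withCherry true true q nil a = eoc-cherry true
  eoc-withCherry true false q nil a = eoc-cherry false
  eoc-withCherry false true q nil a = eoc-cherry true
  eoc-withCherry false false q nil a = eoc-cherry false
  eoc-withCherry true true q (node Y1 c Y2) a with eoc-branch (leaf (suc x)) x (leaf N) q Y1 c Y2
  ... | inj₁ (_ , e) = trans e (eoc-cherry true)
  ... | inj₂ (n , _) = ⊥-elim (n (<-trans (n<1+n x) a))
  eoc-withCherry true false q (node Y1 c Y2) a with eoc-branch (leaf N) x (leaf (suc x)) q Y1 c Y2
  ... | inj₁ (_ , e) = trans e (eoc-cherry false)
  ... | inj₂ (n , _) = ⊥-elim (n (<-trans (n<1+n x) a))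
  eoc-withCherry false true q (node Y1 c Y2) a with eoc-branch Y1 c Y2 q (leaf (suc x)) x (leaf N)
  ... | inj₁ (lt , _) = ⊥-elim (<-asym lt (<-trans (n<1+n x) a))
  ... | inj₂ (_ , e) = trans e (eoc-cherry true)
  eoc-withCherry false false q (node Y1 c Y2) a with eoc-branch Y1 c Y2 q (leaf N) x (leaf (suc x))
  ... | inj₁ (lt , _) = ⊥-elim (<-asym lt (<-trans (n<1+n x) a))
  ... | inj₂ (_ , e) = trans e (eoc-cherry false)

  eoc-withSiblings : ∀ side o q Y → eoc (withSiblings side o q Y) ≡ x
  eoc-withSiblings true true q Y with eoc-branch nil x nil q (leaf N) (suc x) Y
  ... | inj₁ (_ , e) = e
  ... | inj₂ (n , _) = ⊥-elim (n (n<1+n x))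
  eoc-withSiblings true false q Y with eoc-branch nil x nil q Y (suc x) (leaf N)
  ... | inj₁ (_ , e) = e
  ... | inj₂ (n , _) = ⊥-elim (n (n<1+n x))
  eoc-withSiblings false true q Y with eoc-branch (leaf N) (suc x) Y q nil x nil
  ... | inj₁ (lt , _) = ⊥-elim (<-asym lt (n<1+n x))
  ... | inj₂ (_ , e) = e
  eoc-withSiblings false false q Y with eoc-branch Y (suc x) (leaf N) q nil x nil
  ... | inj₁ (lt , _) = ⊥-elim (<-asym lt (n<1+n x))
  ... | inj₂ (_ , e) = e

  HasChild-cherry : ∀ o c → (c ≡ N ⊎ c ≡ suc x) → HasChild (cherry o) x c
  HasChild-cherry true c (inj₁ refl) = here-right refl
  HasChild-cherry true c (inj₂ refl) = here-left refl
  HasChild-cherry false c (inj₁ refl) = here-left refl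
  HasChild-cherry false c (inj₂ refl) = here-right refl

  HasChild-withCherry : ∀ side o q Y c → (c ≡ N ⊎ c ≡ suc x) → HasChild (withCherry side o q Y) x c
  HasChild-withCherry true o q Y c h = in-left (HasChild-cherry o c h)
  HasChild-withCherry false o q Y c h = in-right (HasChild-cherry o c h)

  HasChild-withSiblings : ∀ side o q Y → HasChild (withSiblings side o q Y) (suc x) N
  HasChild-withSiblings true true q Y = in-right (here-left refl)
  HasChild-withSiblings true false q Y = in-right (here-right refl)
  HasChild-withSiblings false true q Y = in-left (here-left refl)
  HasChild-withSiblings false false q Y = in-left (here-right refl)

  Siblings-withSiblings : ∀ side o q Y → Siblings x (withSiblings side o q Y)
  Siblings-withSiblings true true q Y = _ , q , _ , subH , inj₁ (refl , refl)
  Siblings-withSiblings true false q Y = _ , q , _ , subH , inj₁ (refl , refl)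
  Siblings-withSiblings false true q Y = _ , q , _ , subH , inj₂ (refl , refl)
  Siblings-withSiblings false false q Y = _ , q , _ , subH , inj₂ (refl , refl)

  NonNil-withCherry : ∀ side o q Y → NonNil (withCherry side o q Y)
  NonNil-withCherry true _ _ _ = tt
  NonNil-withCherry false _ _ _ = tt

  NonNil-withSiblings : ∀ side o q Y → NonNil (withSiblings side o q Y)
  NonNil-withSiblings true _ _ _ = tt
  NonNil-withSiblings false _ _ _ = tt


RootLabel? : ∀ c u → Dec (RootLabel c u)
RootLabel? c nil = no (λ ())
RootLabel? c (node _ a _) = a ≟ c

HasChild? : ∀ t p c → Dec (HasChild t p c)
HasChild? nil p c = no (λ ())
HasChild? (node l a r) p c with a ≟ p | RootLabel? c l | RootLabel? c r | HasChild? l p c | HasChild? r p c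
... | yes refl | yes rl | _ | _ | _ = yes (Subtree⇒HasChild subH (inj₁ rl))
... | yes refl | _ | yes rr | _ | _ = yes (Subtree⇒HasChild subH (inj₂ rr))
... | _ | _ | _ | yes h | _ = yes (in-left h)
... | _ | _ | _ | _ | yes h = yes (in-right h)
... | no a≢p | _ | _ | no ¬l | no ¬r = no λ
  { (here-left _) → a≢p refl ; (here-right _) → a≢p refl ; (in-left h) → ¬l h ; (in-right h) → ¬r h }
... | yes refl | no ¬cl | no ¬cr | no ¬l | no ¬r = no λ
  { (here-left refl) → ¬cl refl ; (here-right refl) → ¬cr refl ; (in-left h) → ¬l h ; (in-right h) → ¬r h }

AreSiblings? : ∀ a b t → Dec (AreSiblings a b t)
AreSiblings? a b nil = no λ { (_ , _ , _ , () , _) }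
AreSiblings? a b (node l p r) with here? l r | AreSiblings? a b l | AreSiblings? a b r
  where
  here? : ∀ u v → Dec ((RootLabel a u × RootLabel b v) ⊎ (RootLabel b u × RootLabel a v))
  here? u v = (RootLabel? a u ×-dec RootLabel? b v) ⊎-dec (RootLabel? b u ×-dec RootLabel? a v)
... | yes h | _ | _ = yes (l , p , r , subH , h)
... | _ | yes (u , q , v , s , h) | _ = yes (u , q , v , subL s , h)
... | _ | _ | yes (u , q , v , s , h) = yes (u , q , v , subR s , h)
... | no ¬h | no ¬l | no ¬r = no λ
  { (_ , _ , _ , subH , h) → ¬h h
  ; (u , q , v , subL s , h) → ¬l (u , q , v , s , h)
  ; (u , q , v , subR s , h) → ¬r (u , q , v , s , h) }

_↭?_ : (xs ys : List ℕ) → Dec (xs ↭ ys)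
[] ↭? [] = yes Perm.refl
[] ↭? (y ∷ ys) = no (λ p → 0≢1+n (Perm.↭-length p))
(x ∷ xs) ↭? ys with x ∈? ys
... | no x∉ = no (λ p → x∉ (∈-resp-↭ p (here refl)))
... | yes x∈ with ∈-∃++ x∈
...   | us , vs , refl with xs ↭? (us ++ vs)
...     | yes p = yes (Perm.trans (prep x p) (↭-sym (Perm.shift x us vs)))
...     | no ¬p = no (λ q → ¬p (Perm.drop-∷ (Perm.trans q (Perm.shift x us vs))))

Above? : ∀ a u → Dec (Above a u)
Above? a nil = yes tt
Above? a (node _ b _) = a <? b

Increasing? : ∀ t → Dec (Increasing t)
Increasing? nil = yes tt
Increasing? (node l a r) = Above? a l ×-dec Above? a r ×-dec Increasing? l ×-dec Increasing? r

NonNil? : ∀ u → Dec (NonNil u)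
NonNil? nil = no (λ ())
NonNil? (node _ _ _) = yes tt

ZeroOrTwo? : ∀ l r → Dec (ZeroOrTwo l r)
ZeroOrTwo? l r = (isNil? l ×-dec isNil? r) ⊎-dec (NonNil? l ×-dec NonNil? r)
  where
  isNil? : ∀ u → Dec (u ≡ nil)
  isNil? nil = yes refl
  isNil? (node _ _ _) = no (λ ())

AllZeroOrTwo? : ∀ t → Dec (AllZeroOrTwo t)
AllZeroOrTwo? nil = yes tt
AllZeroOrTwo? (node l a r) = ZeroOrTwo? l r ×-dec AllZeroOrTwo? l ×-dec AllZeroOrTwo? r

RightmostException? : ∀ t → Dec (RightmostException t)
RightmostException? nil = no (λ ())
RightmostException? (node l a nil) = NonNil? l ×-dec AllZeroOrTwo? l
RightmostException? (node l a (node r₁ b r₂)) =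
  NonNil? l ×-dec AllZeroOrTwo? l ×-dec RightmostException? (node r₁ b r₂)

InClass? : ∀ N m k t → Dec (InClass N m k t)
InClass? N m k t =
  ((labels t ↭? range N ×-dec RootLabel? 1 t ×-dec Increasing? t) ×-dec
   ((N % 2 ≟ 0 ×-dec RightmostException? t) ⊎-dec (N % 2 ≟ 1 ×-dec AllZeroOrTwo? t))) ×-dec
  eoc t ≟ m ×-dec HasChild? t k N

-- Bijections between refinement types

module _ {A B : Set} {P : A → Set} {Q : B → Set} (P? : ∀ a → Dec (P a)) (Q? : ∀ b → Dec (Q b))
         (f : A → B) (g : B → A)
         (f-ok : ∀ {a} → P a → Q (f a) × g (f a) ≡ a)
         (g-ok : ∀ {b} → Q b → P (g b) × f (g b) ≡ b) where

  -- the proofs are irrelevant, so the inverse laws need them recomputed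
  Refinement-↔ : Refinement A P ↔ Refinement B Q
  Refinement-↔ = mk↔ₛ′ to from to∘from from∘to
    where
    to : Refinement A P → Refinement B Q
    to (a , [ p ]) = f a , [ proj₁ (f-ok p) ]
    from : Refinement B Q → Refinement A P
    from (b , [ q ]) = g b , [ proj₁ (g-ok q) ]
    to∘from : ∀ v → to (from v) ≡ v
    to∘from (b , [ q ]) = value-injective (proj₂ (g-ok (recompute (Q? b) q)))
    from∘to : ∀ v → from (to v) ≡ v
    from∘to (a , [ p ]) = value-injective (proj₂ (f-ok (recompute (P? a) p)))

Refinement-⊎ : {A B : Set} {P : A → Set} {Q : B → Set} →
  Refinement (A ⊎ B) [ P , Q ]′ ↔ (Refinement A P ⊎ Refinement B Q)
Refinement-⊎ {A} {B} {P} {Q} = mk↔ₛ′ to from to∘from from∘to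
  where
  to : Refinement (A ⊎ B) [ P , Q ]′ → Refinement A P ⊎ Refinement B Q
  to (inj₁ a , [ p ]) = inj₁ (a , [ p ])
  to (inj₂ b , [ q ]) = inj₂ (b , [ q ])
  from : Refinement A P ⊎ Refinement B Q → Refinement (A ⊎ B) [ P , Q ]′
  from (inj₁ (a , [ p ])) = inj₁ a , [ p ]
  from (inj₂ (b , [ q ])) = inj₂ b , [ q ]
  to∘from : ∀ v → to (from v) ≡ v
  to∘from (inj₁ _) = refl
  to∘from (inj₂ _) = refl
  from∘to : ∀ v → from (to v) ≡ v
  from∘to (inj₁ _ , _) = refl
  from∘to (inj₂ _ , _) = refl

exchange : ∀ {A A′ B B′ E E′ : Set} → B ↔ (A ⊎ E) → B′ ↔ (A′ ⊎ E′) → E ↔ E′ → (A ⊎ B′) ↔ (B ⊎ A′)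
exchange {A} {A′} {B} {B′} {E} {E′} B≅A⊎E B′≅A′⊎E′ E≅E′ = begin
  (A ⊎ B′)          ↔⟨ ↔-id A ⊎-↔ B′≅A′⊎E′ ⟩
  (A ⊎ (A′ ⊎ E′))   ↔⟨ ↔-id A ⊎-↔ ⊎-comm A′ E′ ⟩
  (A ⊎ (E′ ⊎ A′))   ↔⟨ ↔-sym (⊎-assoc 0ℓ A E′ A′) ⟩
  ((A ⊎ E′) ⊎ A′)   ↔⟨ (↔-id A ⊎-↔ ↔-sym E≅E′) ⊎-↔ ↔-id A′ ⟩
  ((A ⊎ E) ⊎ A′)    ↔⟨ ↔-sym B≅A⊎E ⊎-↔ ↔-id A′ ⟩
  (B ⊎ A′)          ∎
  where open EquationalReasoning

↔⇒≡ : ∀ {m n} → Fin m ↔ Fin n → m ≡ n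
↔⇒≡ f = cantor-schröder-bernstein (Injection.injective (↔⇒↣ f)) (Injection.injective (↔⇒↣ (↔-sym f)))

-- B(x) as A(x) together with the exceptional trees

module AdjacentLabels (N x : ℕ) (2≤x : 2 ≤ x) (1+x<N : suc x < N) (even : N % 2 ≡ 0) where
  open Cherry x N 1+x<N public

  root≢x : ∀ {t} → RootLabel 1 t → root t ≢ x
  root≢x r e = <-irrefl (trans (sym (RootLabel⇒root≡ r)) e) 2≤x

  record CherryView (t : Tree) : Set where
    field
      side o : Bool
      q : ℕ
      Y : Tree
      parent : ParentNode x (withCherry side o q Y) t
      root-Y≢x : rootIs x Y ≡ false
      root-Y≢N : rootIs N Y ≡ false
      Y-above : Above (suc x) Y

  -- both children of x are leaves: x + 1 ends the minimal chain and N is the largest label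
  cherry-of : ∀ {t} → InClass N (suc x) x t → HasChild t x (suc x) → Σ Bool λ o → Subtree (cherry o) t
  cherry-of {t} (cit , e , pom) h with HasChild⇒Subtree h | HasChild⇒Subtree pom
  ... | A , B , sX , co₁ | _ , _ , s′ , coN with subtree-unique (Facts.distinct (facts cit)) s′ sX
  ... | refl , refl = shape co₁ coN
    where
    open Facts (facts cit)
    leaf-1+x : Subtree (leaf (suc x)) t
    leaf-1+x = subst (λ z → Subtree (leaf z) t) e (eoc-leaf t (IsCIT-NonNil cit))
    shape : ChildOf (suc x) A B → ChildOf N A B → Σ Bool λ o → Subtree (cherry o) t
    shape (inj₁ a) (inj₁ b) = ⊥-elim (<-irrefl (trans (sym (RootLabel⇒root≡ a)) (RootLabel⇒root≡ b)) 1+x<N)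
    shape (inj₂ a) (inj₂ b) = ⊥-elim (<-irrefl (trans (sym (RootLabel⇒root≡ a)) (RootLabel⇒root≡ b)) 1+x<N)
    shape (inj₁ a) (inj₂ b) = true , subst (λ u → Subtree u t)
      (cong₂ (λ u v → node u x v) (leaf-left-child distinct sX leaf-1+x a)
        (max-label-leaf increasing bounded (Subtree-trans (subR subH) sX) b)) sX
    shape (inj₂ a) (inj₁ b) = false , subst (λ u → Subtree u t)
      (cong₂ (λ u v → node u x v) (max-label-leaf increasing bounded (Subtree-trans (subL subH) sX) b)
        (leaf-right-child distinct sX leaf-1+x a)) sX

  cherryView : ∀ {t} → InClass N (suc x) x t → HasChild t x (suc x) → CherryView t
  cherryView {t} inT@(cit , e , _) h with cherry-of inT h
  ... | o , sC with ParentNode-exists x t (Subtree-∈T sC (x∈cherry o)) (root≢x rootLabel)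
    where open Facts (facts cit)
  ...   | _ , p with ParentNode-ChildOf p
  ...     | l , q , r , refl , inj₁ rl
    with Subtree-RootLabel-unique distinct (Subtree-trans (subL subH) (ParentNode-Subtree p)) sC rl (RootLabel-cherry o)
    where open Facts (facts cit)
  ...       | refl = record
    { side = true ; o = o ; q = q ; Y = r ; parent = p
    ; root-Y≢x = ∉⇒rootIs-false (dj (x∈cherry o)) ; root-Y≢N = ∉⇒rootIs-false (dj (N∈cherry o))
    ; Y-above = chain-left-sibling-above distinct (ParentNode-Subtree p)
        (subst (_∈T cherry o) (sym e) (1+x∈cherry o)) (RootLabel-cherry o) (1+x∈cherry o) }
    where
    open Facts (facts cit)
    dj = proj₁ (proj₂ (proj₂ (Subtree-Distinct (ParentNode-Subtree p) distinct)))
  cherryView {t} inT@(cit , e , _) h | o , sC | _ , p | l , q , r , refl , inj₂ rr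
    with Subtree-RootLabel-unique distinct (Subtree-trans (subR subH) (ParentNode-Subtree p)) sC rr (RootLabel-cherry o)
    where open Facts (facts cit)
  ... | refl = record
    { side = false ; o = o ; q = q ; Y = l ; parent = p
    ; root-Y≢x = ∉⇒rootIs-false (λ q → dj q (x∈cherry o)) ; root-Y≢N = ∉⇒rootIs-false (λ q → dj q (N∈cherry o))
    ; Y-above = chain-right-sibling-above distinct (ParentNode-Subtree p)
        (subst (_∈T cherry o) (sym e) (1+x∈cherry o)) (RootLabel-cherry o) (1+x∈cherry o) (x∈cherry o) }
    where
    open Facts (facts cit)
    dj = proj₁ (proj₂ (proj₂ (Subtree-Distinct (ParentNode-Subtree p) distinct)))

  record SiblingsView (t : Tree) : Set where
    field
      side o : Bool
      q : ℕ
      Y : Tree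
      parent : ParentNode x (withSiblings side o q Y) t
      root-Y≢x : rootIs x Y ≡ false
      root-Y≢N : rootIs N Y ≡ false

  RootLabel-fork : ∀ o Y → RootLabel (suc x) (fork o Y)
  RootLabel-fork true Y = refl
  RootLabel-fork false Y = refl

  Y⊆fork : ∀ o Y {z} → z ∈T Y → z ∈T fork o Y
  Y⊆fork true Y p = inr p
  Y⊆fork false Y p = inl p

  N∉fork-Y : ∀ o Y → Distinct (fork o Y) → ¬ (N ∈T Y)
  N∉fork-Y true Y (_ , _ , dj , _) p = dj hereT p
  N∉fork-Y false Y (_ , _ , dj , _) p = dj p hereT

  -- N is a leaf below its parent x + 1
  fork-of : ∀ {t} → InClass N x (suc x) t → Σ Bool λ o → Σ Tree λ Y → Subtree (fork o Y) t
  fork-of {t} (cit , _ , pom) with HasChild⇒Subtree pom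
  ... | A , B , sZ , inj₁ rA = true , B ,
    subst (λ w → Subtree (node w (suc x) B) t) (max-label-leaf increasing bounded (Subtree-trans (subL subH) sZ) rA) sZ
    where open Facts (facts cit)
  ... | A , B , sZ , inj₂ rB = false , A ,
    subst (λ w → Subtree (node A (suc x) w) t) (max-label-leaf increasing bounded (Subtree-trans (subR subH) sZ) rB) sZ
    where open Facts (facts cit)

  siblingsView : ∀ {t} → InClass N x (suc x) t → Siblings x t → SiblingsView t
  siblingsView {t} inT@(cit , e , _) (u , a , v , s , inj₁ (ru , rv)) with fork-of inT
  ... | o , Y , sF with leaf-left-child distinct s leaf-x ru
                      | Subtree-RootLabel-unique distinct (Subtree-trans (subR subH) s) sF rv (RootLabel-fork o Y)
    where open Facts (facts cit)
          leaf-x = subst (λ z → Subtree (leaf z) t) e (eoc-leaf t (IsCIT-NonNil cit))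
  ... | refl | refl = record
    { side = true ; o = o ; q = a ; Y = Y
    ; parent = Subtree⇒ParentNode distinct increasing s (inj₁ refl) (root≢x rootLabel)
    ; root-Y≢x = ∉⇒rootIs-false (λ p → dj hereT (Y⊆fork o Y p))
    ; root-Y≢N = ∉⇒rootIs-false (N∉fork-Y o Y (proj₂ (proj₂ (proj₂ (proj₂ ds))))) }
    where
    open Facts (facts cit)
    ds = Subtree-Distinct s distinct
    dj = proj₁ (proj₂ (proj₂ ds))
  siblingsView {t} inT@(cit , e , _) (u , a , v , s , inj₂ (ru , rv)) with fork-of inT
  ... | o , Y , sF with leaf-right-child distinct s leaf-x rv
                      | Subtree-RootLabel-unique distinct (Subtree-trans (subL subH) s) sF ru (RootLabel-fork o Y)
    where open Facts (facts cit)
          leaf-x = subst (λ z → Subtree (leaf z) t) e (eoc-leaf t (IsCIT-NonNil cit))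
  ... | refl | refl = record
    { side = false ; o = o ; q = a ; Y = Y
    ; parent = Subtree⇒ParentNode distinct increasing s (inj₂ refl) (root≢x rootLabel)
    ; root-Y≢x = ∉⇒rootIs-false (λ p → dj (Y⊆fork o Y p) hereT)
    ; root-Y≢N = ∉⇒rootIs-false (N∉fork-Y o Y (proj₁ (proj₂ (proj₂ (proj₂ ds))))) }
    where
    open Facts (facts cit)
    ds = Subtree-Distinct s distinct
    dj = proj₁ (proj₂ (proj₂ ds))

  -- x's parent is on the right spine and its left child is the cherry x(N, x + 1)
  exceptionalᵇ : Tree → Bool
  exceptionalᵇ t = proj₂ (locateParent x t) ∧ does (leftOf (proj₁ (locateParent x t)) ≟T cherry false)

  exceptionalᵇ-ParentNode : ∀ {s t} (p : ParentNode x s t) →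
    exceptionalᵇ t ≡ onSpine p ∧ does (leftOf s ≟T cherry false)
  exceptionalᵇ-ParentNode p =
    cong (λ w → proj₂ w ∧ does (leftOf (proj₁ w) ≟T cherry false)) (locateParent-ParentNode p)

  cherry-true≢false : does (cherry true ≟T cherry false) ≡ false
  cherry-true≢false = dec-false (cherry true ≟T cherry false)
    (λ e → <-irrefl (cong (λ { (node (node _ a _) _ _) → a ; _ → 0 }) e) 1+x<N)

  cherry-false≡false : does (cherry false ≟T cherry false) ≡ true
  cherry-false≡false = dec-true (cherry false ≟T cherry false) refl

  open AtParent x

  cherry⇒siblings-step : ∀ {t} → InClass N (suc x) x t → HasChild t x (suc x) → exceptionalᵇ t ≡ false →
    let t' = atParent x cherry⇒siblings t in
    InClass N x (suc x) t' × Siblings x t' × atParent x siblings⇒cherry t' ≡ t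
  cherry⇒siblings-step {t} inT@(cit , e , _) h notExc =
    atParent-InClass cherry⇒siblings α even inT eoc∈ (eoc-withSiblings side o q Y) (HasChild-withSiblings side o q Y) ,
    AreSiblings-Subtree (Subtree-atParent cherry⇒siblings ρ parent)
      (subst (Siblings x) (sym result) (Siblings-withSiblings side o q Y)) ,
    atParent-inverse cherry⇒siblings ρ
      (subst (λ u → hasChildᵇ x u ≡ true) (sym result) (hasChildᵇ-withSiblings side o q Y))
      siblings⇒cherry parent (trans (cong siblings⇒cherry result) (siblings⇒cherry-withSiblings side o q Y root-Y≢N))
    where
    open CherryView (cherryView inT h)
    open Facts (facts cit)
    s = withCherry side o q Y
    eoc∈ : eoc t ∈T s
    eoc∈ = subst (_∈T s) (sym e) (1+x∈withCherry side o)
      where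
      1+x∈withCherry : ∀ side o → suc x ∈T withCherry side o q Y
      1+x∈withCherry true o = inl (1+x∈cherry o)
      1+x∈withCherry false o = inr (1+x∈cherry o)
    onSpine⇒fine : onSpine parent ≡ true → does (leftOf s ≟T cherry false) ≡ false
    onSpine⇒fine sp =
      trans (sym (cong (_∧ does (leftOf s ≟T cherry false)) sp)) (trans (sym (exceptionalᵇ-ParentNode parent)) notExc)
    rightmost : ∀ side o → RightmostException (withCherry side o q Y) →
      does (leftOf (withCherry side o q Y) ≟T cherry false) ≡ false →
      RightmostException (withSiblings side o q Y)
    rightmost true true re _ = RightmostException-withCherry⇒withSiblings q Y re
    rightmost true false re c = ⊥-elim (true≢false (trans (sym cherry-false≡false) c))
    rightmost false o re _ = ⊥-elim (true≢false (sym (RightmostException-withCherry-side false o q Y re)))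
    α : Admissible cherry⇒siblings parent (withSiblings side o q Y)
    α = record
      { result = cherry⇒siblings-withCherry side o q Y root-Y≢x
      ; root-≡ = trans (root-withSiblings side o q Y) (sym (root-withCherry side o q Y))
      ; nonNil = NonNil-withSiblings side o q Y
      ; labels-↭ = labels-withSiblings-withCherry side o q Y
      ; increasing = Increasing-withCherry⇒withSiblings side o q Y
          (Subtree-Increasing (ParentNode-Subtree parent) increasing) Y-above
      ; allZeroOrTwo = AllZeroOrTwo-withCherry⇒withSiblings side o q Y
      ; rightmost = λ sp re → rightmost side o re (onSpine⇒fine (RightSpine⇒onSpine distinct parent sp)) }
    open Admissible cherry⇒siblings α using (result; replacement)
    ρ = replacement

  siblings⇒cherry-step : ∀ {t} → InClass N x (suc x) t → Siblings x t →
    let t' = atParent x siblings⇒cherry t in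
    InClass N (suc x) x t' × HasChild t' x (suc x) × exceptionalᵇ t' ≡ false × atParent x cherry⇒siblings t' ≡ t
  siblings⇒cherry-step {t} inT@(cit@(_ , complete) , e , _) sib =
    atParent-InClass siblings⇒cherry α even inT eoc∈ (eoc-withCherry side o q Y Y-above)
      (HasChild-withCherry side o q Y N (inj₁ refl)) ,
    HasChild-Subtree (Subtree-atParent siblings⇒cherry ρ parent)
      (subst (λ u → HasChild u x (suc x)) (sym result) (HasChild-withCherry side o q Y (suc x) (inj₂ refl))) ,
    trans (cong (λ w → proj₂ w ∧ does (leftOf (proj₁ w) ≟T cherry false))
                (locateParent-atParent siblings⇒cherry ρ g-hasChild parent))
      (trans (cong (λ w → onSpine parent ∧ does (leftOf w ≟T cherry false)) result) notExceptional) ,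
    atParent-inverse siblings⇒cherry ρ g-hasChild cherry⇒siblings parent
      (trans (cong cherry⇒siblings result) (cherry⇒siblings-withCherry side o q Y root-Y≢x))
    where
    open SiblingsView (siblingsView inT sib)
    open Facts (facts cit)
    s = withSiblings side o q Y
    eoc∈ : eoc t ∈T s
    eoc∈ = subst (_∈T s) (sym e) (x∈withSiblings side o)
      where
      x∈withSiblings : ∀ side o → x ∈T withSiblings side o q Y
      x∈withSiblings true o = inl hereT
      x∈withSiblings false o = inr hereT
    increasing′ =
      Increasing-withSiblings⇒withCherry side o q Y (Subtree-Increasing (ParentNode-Subtree parent) increasing)
    Y-above = proj₂ increasing′
    rightmost : ∀ side o → RightmostException (withSiblings side o q Y) →
      RightmostException (withCherry side o q Y)
    rightmost true true re = RightmostException-withSiblings⇒withCherry q Y re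
    rightmost true false re =
      ⊥-elim (true≢false (sym (proj₂ (RightmostException-withSiblings-side true false q Y re))))
    rightmost false o re =
      ⊥-elim (true≢false (sym (proj₁ (RightmostException-withSiblings-side false o q Y re))))
    α : Admissible siblings⇒cherry parent (withCherry side o q Y)
    α = record
      { result = siblings⇒cherry-withSiblings side o q Y root-Y≢N
      ; root-≡ = trans (root-withCherry side o q Y) (sym (root-withSiblings side o q Y))
      ; nonNil = NonNil-withCherry side o q Y
      ; labels-↭ = ↭-sym (labels-withSiblings-withCherry side o q Y)
      ; increasing = proj₁ increasing′
      ; allZeroOrTwo = AllZeroOrTwo-withSiblings⇒withCherry side o q Y
      ; rightmost = λ _ → rightmost side o }
    open Admissible siblings⇒cherry α using (result; replacement)
    ρ = replacement
    g-hasChild : hasChildᵇ x (siblings⇒cherry s) ≡ true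
    g-hasChild = subst (λ u → hasChildᵇ x u ≡ true) (sym result) (hasChildᵇ-withCherry side o q Y)
    notExceptional : onSpine parent ∧ does (leftOf (withCherry side o q Y) ≟T cherry false) ≡ false
    notExceptional with onSpine parent in sp
    ... | false = refl
    ... | true = fine side o (RightSpine-RightmostException (NonNil-withSiblings side o q Y)
                   (onSpine⇒RightSpine parent sp)
                   (even-RightmostException {N} even complete))
      where
      fine : ∀ side o → RightmostException (withSiblings side o q Y) →
        does (leftOf (withCherry side o q Y) ≟T cherry false) ≡ false
      fine true true _ = cherry-true≢false
      fine true false re =
        ⊥-elim (true≢false (sym (proj₂ (RightmostException-withSiblings-side true false q Y re))))
      fine false o re = ⊥-elim (true≢false (sym (proj₁ (RightmostException-withSiblings-side false o q Y re))))

  Exceptional : Tree → Set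
  Exceptional t = InClass N (suc x) x t × HasChild t x (suc x) × exceptionalᵇ t ≡ true

  Exceptional? : ∀ t → Dec (Exceptional t)
  Exceptional? t = InClass? N (suc x) x t ×-dec HasChild? t x (suc x) ×-dec (exceptionalᵇ t Bool.≟ true)

  open Transposition N x 2≤x 1+x<N

  split : Tree → Tree ⊎ Tree
  split t with HasChild? t x (suc x) | exceptionalᵇ t
  ... | no _  | _     = inj₁ (relabel τ t)
  ... | yes _ | false = inj₁ (atParent x cherry⇒siblings t)
  ... | yes _ | true  = inj₂ t

  merge : Tree ⊎ Tree → Tree
  merge (inj₁ t) with AreSiblings? x (suc x) t
  ... | yes _ = atParent x siblings⇒cherry t
  ... | no _  = relabel τ t
  merge (inj₂ t) = t

  split-ok : ∀ {t} → InClass N (suc x) x t →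
    [ InClass N x (suc x) , Exceptional ]′ (split t) × merge (split t) ≡ t
  split-ok {t} inT with HasChild? t x (suc x) | exceptionalᵇ t in exc
  ... | no ¬h | _ with transpose-B⇒A inT ¬h
  ...   | inτt , ¬sib with AreSiblings? x (suc x) (relabel τ t)
  ...     | yes sib = ⊥-elim (¬sib sib)
  ...     | no _ = inτt , relabel-inverse (transpose-involutive x) t
  split-ok {t} inT | yes h | false with cherry⇒siblings-step inT h exc
  ...   | inT' , sib , inverse with AreSiblings? x (suc x) (atParent x cherry⇒siblings t)
  ...     | yes _ = inT' , inverse
  ...     | no ¬sib = ⊥-elim (¬sib sib)
  split-ok {t} inT | yes h | true = (inT , h , exc) , refl

  merge-ok : ∀ {u} → [ InClass N x (suc x) , Exceptional ]′ u →
    InClass N (suc x) x (merge u) × split (merge u) ≡ u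
  merge-ok {inj₁ t} inT with AreSiblings? x (suc x) t
  ... | yes sib with siblings⇒cherry-step inT sib
  ...   | inT' , h , notExc , inverse with HasChild? (atParent x siblings⇒cherry t) x (suc x)
  ...     | no ¬h = ⊥-elim (¬h h)
  ...     | yes _ rewrite notExc = inT' , cong inj₁ inverse
  merge-ok {inj₁ t} inT | no ¬sib with transpose-A⇒B inT ¬sib
  ...   | inτt , ¬h with HasChild? (relabel τ t) x (suc x)
  ...     | yes h = ⊥-elim (¬h h)
  ...     | no _ = inτt , cong inj₁ (relabel-inverse (transpose-involutive x) t)
  merge-ok {inj₂ t} (inT , h , exc) with HasChild? t x (suc x)
  ... | no ¬h = ⊥-elim (¬h h)
  ... | yes _ rewrite exc = inT , refl

  decomposition : Refinement Tree (InClass N (suc x) x) ↔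
    (Refinement Tree (InClass N x (suc x)) ⊎ Refinement Tree Exceptional)
  decomposition =
    ↔-trans (Refinement-↔ (InClass? N (suc x) x) split-class? split merge split-ok merge-ok) Refinement-⊎
    where
    split-class? : ∀ u → Dec ([ InClass N x (suc x) , Exceptional ]′ u)
    split-class? (inj₁ t) = InClass? N x (suc x) t
    split-class? (inj₂ t) = Exceptional? t

  record ExceptionalView (t : Tree) : Set where
    field
      q : ℕ
      Y : Tree
      parent : ParentNode x (node (cherry false) q Y) t
      parent-onSpine : onSpine parent ≡ true
      Y-above : Above (suc x) Y

  exceptionalView : ∀ {t} → Exceptional t → ExceptionalView t
  exceptionalView {t} ((cit , e , pom) , _ , exc)
    with ParentNode-exists x t (HasChild-∈T-parent pom) (root≢x (Facts.rootLabel (facts cit)))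
  ... | _ , p with ParentNode-ChildOf p
  ...   | l , q , r , refl , _ with onSpine p in sp | l ≟T cherry false | trans (sym (exceptionalᵇ-ParentNode p)) exc
  ...     | true | yes refl | _ = record
    { q = q ; Y = r ; parent = p ; parent-onSpine = sp
    ; Y-above = chain-left-sibling-above (Facts.distinct (facts cit)) (ParentNode-Subtree p)
        (subst (_∈T cherry false) (sym e) (inr hereT)) refl (inr hereT) }
  ...     | true | no _ | ()
  ...     | false | _ | ()

  exceptionalᵇ-true : ∀ {t q Y} (p : ParentNode x (node (cherry false) q Y) t) → onSpine p ≡ true →
    exceptionalᵇ t ≡ true
  exceptionalᵇ-true p sp =
    trans (exceptionalᵇ-ParentNode p) (trans (cong (_∧ does (cherry false ≟T cherry false)) sp) cherry-false≡false)

-- Exceptional trees for x and for x + 1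

module ExceptionalShift (N x : ℕ) (2≤x : 2 ≤ x) (2+x<N : suc (suc x) < N) (even : N % 2 ≡ 0) where

  1+x<N : suc x < N
  1+x<N = <-trans (n<1+n _) 2+x<N

  module L₀ = AdjacentLabels N x 2≤x 1+x<N even
  module L₁ = AdjacentLabels N (suc x) (≤-trans 2≤x (n≤1+n x)) 2+x<N even

  cherry₀ cherry₁ : Tree
  cherry₀ = L₀.cherry false
  cherry₁ = L₁.cherry false

  x<2+x : x < suc (suc x)
  x<2+x = <-trans (n<1+n x) (n<1+n (suc x))

  -- q(x(N, x + 1), x + 2(L, R))  becomes  q(L, x(x + 1(N, x + 2), R))
  before : ℕ → Tree → Tree → Tree
  before q L R = node cherry₀ q (node L (suc (suc x)) R)

  raise : Tree → Tree
  raise (node _ q (node L _ R)) = node L q (node cherry₁ x R)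
  raise u = u

  lower : Tree → Tree
  lower (node L q (node _ _ R)) = before q L R
  lower u = u

  labels-raise : ∀ q L R → labels (raise (before q L R)) ↭ labels (before q L R)
  labels-raise q L R =
    ↭-sym (Perm.trans (Perm.++-comm (N ∷ x ∷ suc x ∷ q ∷ []) (labels L ++ suc (suc x) ∷ labels R))
    (Perm.trans (Perm.++-assoc (labels L) (suc (suc x) ∷ labels R) (N ∷ x ∷ suc x ∷ q ∷ []))
    (Perm.++⁺ˡ (labels L) (Perm.trans (prep (suc (suc x)) (Perm.++-comm (labels R) (N ∷ x ∷ suc x ∷ q ∷ [])))
      (Perm.trans (prep (suc (suc x)) (prep N (prep x (swap (suc x) q Perm.refl))))
      (Perm.trans (prep (suc (suc x)) (prep N (swap x q Perm.refl)))
      (Perm.trans (prep (suc (suc x)) (swap N q Perm.refl))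
      (Perm.trans (swap (suc (suc x)) q Perm.refl)
      (Perm.trans (prep q (swap (suc (suc x)) N Perm.refl))
      (Perm.trans (prep q (prep N (prep (suc (suc x)) (swap x (suc x) Perm.refl))))
        (prep q (prep N (swap (suc (suc x)) (suc x) Perm.refl)))))))))))))

  Increasing-raise : ∀ q L R → Increasing (before q L R) → Increasing (raise (before q L R))
  Increasing-raise q L R (q<x , q<2+x , _ , (aL , aR , iL , iR)) =
    Above-< q<2+x aL , q<x , iL , (n<1+n x , Above-< x<2+x aR , L₁.Increasing-cherry false , iR)

  Increasing-lower : ∀ q L R → Increasing (raise (before q L R)) → Above (suc (suc x)) L →
    Above (suc (suc x)) R →
    Increasing (before q L R)
  Increasing-lower q L R (_ , q<x , iL , (_ , _ , _ , iR)) aL aR =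
    q<x , <-trans q<x x<2+x , L₀.Increasing-cherry false , (aL , aR , iL , iR)

  AllZeroOrTwo-raise : ∀ q L R → NonNil L → AllZeroOrTwo (before q L R) → AllZeroOrTwo (raise (before q L R))
  AllZeroOrTwo-raise q (node _ _ _) (node _ _ _) _ (_ , _ , (_ , aL , aR)) =
    inj₂ (tt , tt) , aL , (inj₂ (tt , tt) , L₁.AllZeroOrTwo-cherry false , aR)
  AllZeroOrTwo-raise q (node _ _ _) nil _ (_ , _ , (inj₁ (() , _) , _))
  AllZeroOrTwo-raise q (node _ _ _) nil _ (_ , _ , (inj₂ (_ , ()) , _))

  AllZeroOrTwo-lower : ∀ q L R → AllZeroOrTwo (raise (before q L R)) → AllZeroOrTwo (before q L R)
  AllZeroOrTwo-lower q (node _ _ _) (node _ _ _) (_ , aL , (_ , _ , aR)) =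
    inj₂ (tt , tt) , L₀.AllZeroOrTwo-cherry false , (inj₂ (tt , tt) , aL , aR)
  AllZeroOrTwo-lower q nil R (inj₁ (_ , ()) , _)
  AllZeroOrTwo-lower q nil R (inj₂ (() , _) , _)
  AllZeroOrTwo-lower q (node _ _ _) nil (_ , _ , (inj₁ (() , _) , _))
  AllZeroOrTwo-lower q (node _ _ _) nil (_ , _ , (inj₂ (_ , ()) , _))

  RightmostException-before⇒NonNil : ∀ q L R → RightmostException (before q L R) → NonNil L
  RightmostException-before⇒NonNil q L nil (_ , _ , (nL , _)) = nL
  RightmostException-before⇒NonNil q L (node _ _ _) (_ , _ , (nL , _)) = nL

  RightmostException-raise : ∀ q L R → RightmostException (before q L R) →
    RightmostException (raise (before q L R))
  RightmostException-raise q L nil (_ , _ , (nL , aL)) = nL , aL , (tt , L₁.AllZeroOrTwo-cherry false)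
  RightmostException-raise q L (node _ _ _) (_ , _ , (nL , aL , re)) =
    nL , aL , (tt , L₁.AllZeroOrTwo-cherry false , re)

  RightmostException-lower : ∀ q L R → RightmostException (raise (before q L R)) →
    RightmostException (before q L R)
  RightmostException-lower q L nil (nL , aL , _) = tt , L₀.AllZeroOrTwo-cherry false , (nL , aL)
  RightmostException-lower q L (node _ _ _) (nL , aL , (_ , _ , re)) =
    tt , L₀.AllZeroOrTwo-cherry false , (nL , aL , re)

  eoc-raise : ∀ q L R → NonNil L → Increasing (before q L R) → eoc (raise (before q L R)) ≡ suc (suc x)
  eoc-raise q (node L₁ b L₂) R _ (_ , _ , _ , (2+x<b , aR , _)) with eoc-branch L₁ b L₂ q cherry₁ x R
  ... | inj₁ (b<x , _) = ⊥-elim (<-asym b<x (<-trans x<2+x 2+x<b))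
  ... | inj₂ (_ , e) = trans e (right R aR)
    where
    right : ∀ R → Above (suc (suc x)) R → eoc (node cherry₁ x R) ≡ suc (suc x)
    right nil _ = L₁.eoc-cherry false
    right (node R₁ c R₂) 2+x<c with eoc-branch (leaf N) (suc x) (leaf (suc (suc x))) x R₁ c R₂
    ... | inj₁ (_ , e′) = trans e′ (L₁.eoc-cherry false)
    ... | inj₂ (≮ , _) = ⊥-elim (≮ (<-trans (n<1+n (suc x)) 2+x<c))

  eoc-before : ∀ q L R → eoc (before q L R) ≡ suc x
  eoc-before q L R with eoc-branch (leaf N) x (leaf (suc x)) q L (suc (suc x)) R
  ... | inj₁ (_ , e) = trans e (L₀.eoc-cherry false)
  ... | inj₂ (≮ , _) = ⊥-elim (≮ x<2+x)

  raiseᵇ : Tree → Bool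
  raiseᵇ t = rootIs (suc (suc x)) (rightOf (proj₁ (locateParent x t)))

  lowerᵇ : Tree → Bool
  lowerᵇ t = does (root (proj₁ (locateParent (suc x) t)) ≟ x)

  shiftUp shiftDown : Tree → Tree
  shiftUp t = if raiseᵇ t then atParent x raise t else relabel (rotate x) t
  shiftDown t = if lowerᵇ t then atParent x lower t else relabel (rotate⁻¹ x) t

  open AtParent x

  raise-step : ∀ {t q L R} → InClass N (suc x) x t → (p : ParentNode x (before q L R) t) → onSpine p ≡ true →
    let t' = atParent x raise t in
    L₁.Exceptional t' × lowerᵇ t' ≡ true × atParent x lower t' ≡ t
  raise-step {t} {q} {L} {R} inT@(cit@(_ , complete) , e , _) p sp =
    (inT' , HasChild-Subtree (Subtree-atParent raise ρ p) (in-right (in-left (here-right refl))) ,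
     L₁.exceptionalᵇ-true p₁ onSpine-p₁) ,
    trans (cong (λ w → does (root (proj₁ w) ≟ x)) (locateParent-ParentNode p₁)) (dec-true (x ≟ x) refl) ,
    atParent-inverse raise ρ (hasChildᵇ-right x L q (node cherry₁ x R) refl) lower p refl
    where
    open Facts (facts cit)
    nonNil-L = RightmostException-before⇒NonNil q L R
      (RightSpine-RightmostException tt (onSpine⇒RightSpine p sp) (even-RightmostException {N} even complete))
    α : Admissible raise p (raise (before q L R))
    α = record
      { result = refl ; root-≡ = refl ; nonNil = tt ; labels-↭ = labels-raise q L R
      ; increasing = Increasing-raise q L R (Subtree-Increasing (ParentNode-Subtree p) increasing)
      ; allZeroOrTwo = AllZeroOrTwo-raise q L R nonNil-L
      ; rightmost = λ _ → RightmostException-raise q L R }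
    ρ = Admissible.replacement raise α
    inT' : InClass N (suc (suc x)) (suc x) (atParent x raise t)
    inT' = atParent-InClass raise α even inT (subst (_∈T before q L R) (sym e) (inl (inr hereT)))
      (eoc-raise q L R nonNil-L (Subtree-Increasing (ParentNode-Subtree p) increasing))
      (in-right (in-left (here-left refl)))
    p₁-onSpine =
      RightSpine⇒ParentNode (≤-trans 2≤x (n≤1+n x)) (proj₁ inT') (inj₁ refl)
        (RightSpine-trans (spine-right spine-here) (RightSpine-atParent raise ρ p sp))
    p₁ = proj₁ p₁-onSpine
    onSpine-p₁ = proj₂ p₁-onSpine

  above-2+x : ∀ {c} → x ≤ c → c ≢ x → c ≢ suc x → c ≢ suc (suc x) → suc (suc x) < c
  above-2+x x≤c c≢x c≢1+x c≢2+x =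
    ≤∧≢⇒< (≤∧≢⇒< (≤∧≢⇒< x≤c (≢-sym c≢x)) (≢-sym c≢1+x)) (≢-sym c≢2+x)

  lower-step : ∀ {t q L R} → InClass N (suc (suc x)) (suc x) t → (p : ParentNode x (raise (before q L R)) t) →
    onSpine p ≡ true →
    let t' = atParent x lower t in
    L₀.Exceptional t' × raiseᵇ t' ≡ true × atParent x raise t' ≡ t
  lower-step {t} {q} {L} {R} inT@(cit@(_ , complete) , e , _) p sp =
    (inT' , HasChild-Subtree (Subtree-atParent lower ρ p) (in-left (here-right refl)) ,
     trans (cong (λ w → proj₂ w ∧ does (leftOf (proj₁ w) ≟T cherry₀)) located)
       (trans (cong (_∧ does (cherry₀ ≟T cherry₀)) sp) (dec-true (cherry₀ ≟T cherry₀) refl))) ,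
    trans (cong (λ w → rootIs (suc (suc x)) (rightOf (proj₁ w))) located) (≡ᵇ-refl x) ,
    atParent-inverse lower ρ lower-hasChild raise p refl
    where
    open Facts (facts cit)
    s = raise (before q L R)
    sS = ParentNode-Subtree p
    nonNil-L : NonNil L
    nonNil-L =
      proj₁ (RightSpine-RightmostException tt (onSpine⇒RightSpine p sp) (even-RightmostException {N} even complete))
    R-above : ∀ {R} → Increasing (node cherry₁ x R) → Distinct (node cherry₁ x R) → Above (suc (suc x)) R
    R-above {nil} _ _ = tt
    R-above {node _ c _} (_ , x<c , _) (_ , _ , dj , _) =
      above-2+x (<⇒≤ x<c) (≢-sym (<⇒≢ x<c)) (λ { refl → dj hereT hereT }) (λ { refl → dj (inr hereT) hereT })
    -- the minimal chain goes right at q, so root L > x; it also avoids x + 1 and x + 2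
    L-above : ∀ {L} → Subtree (node L q (node cherry₁ x R)) t → NonNil L → Above (suc (suc x)) L
    L-above {node _ c _} s′ _ =
      above-2+x (≮⇒≥ (chain-right⇒≮ distinct s′ (subst (_∈T node cherry₁ x R) (sym e) (inl (inr hereT))) tt))
        (λ { refl → dj hereT hereT }) (λ { refl → dj hereT (inl hereT) }) (λ { refl → dj hereT (inl (inr hereT)) })
      where dj = proj₁ (proj₂ (proj₂ (Subtree-Distinct s′ distinct)))
    increasing-s = Subtree-Increasing sS increasing
    α : Admissible lower p (before q L R)
    α = record
      { result = refl ; root-≡ = refl ; nonNil = tt ; labels-↭ = ↭-sym (labels-raise q L R)
      ; increasing = Increasing-lower q L R increasing-s (L-above sS nonNil-L)
          (R-above (proj₂ (proj₂ (proj₂ increasing-s))) (proj₂ (proj₂ (proj₂ (proj₂ (Subtree-Distinct sS distinct))))))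
      ; allZeroOrTwo = AllZeroOrTwo-lower q L R
      ; rightmost = λ _ → RightmostException-lower q L R }
    ρ = Admissible.replacement lower α
    lower-hasChild : hasChildᵇ x (lower s) ≡ true
    lower-hasChild = hasChildᵇ-left x cherry₀ q (node L (suc (suc x)) R) refl
    inT' : InClass N (suc x) x (atParent x lower t)
    inT' = atParent-InClass lower α even inT (subst (_∈T s) (sym e) (inr (inl (inr hereT))))
      (eoc-before q L R) (in-left (here-left refl))
    located : locateParent x (atParent x lower t) ≡ (before q L R , onSpine p)
    located = locateParent-atParent lower ρ lower-hasChild p

  rotation : Relabelling N (rotate x)
  rotation = record
    { fixes-1 = rotate-< x 1 2≤x
    ; fixes-N = rotate-> x N 2+x<N
    ; permutes = subst (_↭ range N) (sym (List.map-∘ (range N)))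
        (Perm.trans (Perm.map⁺ (transpose x) (transpose-range (suc x) N (s≤s z≤n) (<⇒≤ 2+x<N)))
                    (transpose-range x N (≤-trans (s≤s z≤n) 2≤x) (<⇒≤ 1+x<N))) }

  rotation⁻¹ : Relabelling N (rotate⁻¹ x)
  rotation⁻¹ = record
    { fixes-1 = rotate⁻¹-< x 1 2≤x
    ; fixes-N = rotate⁻¹-> x N 2+x<N
    ; permutes = subst (_↭ range N) (sym (List.map-∘ (range N)))
        (Perm.trans (Perm.map⁺ (transpose (suc x)) (transpose-range x N (≤-trans (s≤s z≤n) 2≤x) (<⇒≤ 1+x<N)))
                    (transpose-range (suc x) N (s≤s z≤n) (<⇒≤ 2+x<N))) }

  relabel-cherry₀ : relabel (rotate x) cherry₀ ≡ cherry₁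
  relabel-cherry₀ = cong₂ (λ n (w : ℕ × ℕ) → node (leaf n) (proj₁ w) (leaf (proj₂ w)))
    (rotate-> x N 2+x<N) (cong₂ _,_ (rotate-x x) (rotate-1+x x))

  relabel-cherry₁ : relabel (rotate⁻¹ x) cherry₁ ≡ cherry₀
  relabel-cherry₁ = cong₂ (λ n (w : ℕ × ℕ) → node (leaf n) (proj₁ w) (leaf (proj₂ w)))
    (rotate⁻¹-> x N 2+x<N) (cong₂ _,_ (rotate⁻¹-1+x x) (rotate⁻¹-2+x x))

  rotate-step : ∀ {t q Y} → L₀.Exceptional t → (p : ParentNode x (node cherry₀ q Y) t) → onSpine p ≡ true →
    rootIs (suc (suc x)) Y ≡ false →
    let t' = relabel (rotate x) t in
    L₁.Exceptional t' × lowerᵇ t' ≡ false × relabel (rotate⁻¹ x) t' ≡ t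
  rotate-step {t} {q} {Y} (inT@(cit , e , _) , h , _) p sp Y≢2+x =
    (inT' , subst₂ (HasChild t') (rotate-x x) (rotate-1+x x) (relabel-HasChild (rotate x) h) ,
     L₁.exceptionalᵇ-true p₁ onSpine-p₁) ,
    trans (cong (λ w → does (root (proj₁ w) ≟ x)) (locateParent-ParentNode p₁)) (dec-false (q ≟ x) (<⇒≢ q<x)) ,
    relabel-inverse (rotate⁻¹-rotate x) t
    where
    open Facts (facts cit)
    t' = relabel (rotate x) t
    sS = ParentNode-Subtree p
    sC : Subtree cherry₀ t
    sC = Subtree-trans (subL subH) sS
    q<x : q < x
    q<x = proj₁ (Subtree-Increasing sS increasing)
    leaf-1+x : Subtree (leaf (suc x)) t
    leaf-1+x = subst (λ z → Subtree (leaf z) t) e (eoc-leaf t (IsCIT-NonNil cit))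
    2+x≢N : suc (suc x) ≢ N
    2+x≢N = <⇒≢ 2+x<N
    noEdge : ∀ {p c} → HasChild t p c → ¬ ((p ≡ suc x × c ≡ suc (suc x)) ⊎ (p ≡ x × c ≡ suc (suc x)))
    noEdge h′ (inj₁ (refl , refl)) = leaf-noChild distinct leaf-1+x h′
    noEdge h′ (inj₂ (refl , refl)) with HasChild⇒Subtree h′
    ... | _ , _ , s′ , co with subtree-unique distinct s′ sC
    ... | refl , refl with co
    ... | inj₁ e′ = 2+x≢N (sym e′)
    ... | inj₂ e′ = 1+n≢n (sym e′)
    noSib : ∀ {a b} → AreSiblings a b t → ¬ ((a ≡ suc x × b ≡ suc (suc x)) ⊎ (a ≡ x × b ≡ suc (suc x)))
    noSib (u , a , v , s′ , inj₁ (ru , rv)) (inj₁ (refl , refl))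
      with parent-node-unique distinct increasing s′ (inj₁ ru) sC (inj₂ refl)
    ... | refl = 1+n≢n (sym rv)
    noSib (u , a , v , s′ , inj₂ (ru , rv)) (inj₁ (refl , refl))
      with parent-node-unique distinct increasing s′ (inj₂ rv) sC (inj₂ refl)
    ... | refl = 2+x≢N (sym ru)
    noSib (u , a , v , s′ , inj₁ (ru , rv)) (inj₂ (refl , refl))
      with parent-node-unique distinct increasing s′ (inj₁ ru) sS (inj₁ refl)
    ... | refl = true≢false (trans (sym (RootLabel⇒rootIs rv)) Y≢2+x)
    noSib (u , a , v , s′ , inj₂ (ru , rv)) (inj₂ (refl , refl))
      with parent-node-unique distinct increasing s′ (inj₂ rv) sS (inj₁ refl)
    ... | refl = <-irrefl ru x<2+x
    compatible : Compatible (rotate x) t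
    compatible = Compatible-avoiding (rotate x) _ t increasing
      (λ lt bad → rotate-mono x lt (bad ∘ inj₁) (bad ∘ inj₂)) noEdge noSib
    inT' : InClass N (suc (suc x)) (suc x) t'
    inT' =
      subst₂ (λ m k → InClass N m k t') (rotate-1+x x) (rotate-x x) (relabel-InClass rotation compatible inT)
    p₁-onSpine = RightSpine⇒ParentNode (≤-trans 2≤x (n≤1+n x)) (proj₁ inT') (inj₁ refl)
      (subst (λ w → RightSpine w t')
        (cong₂ (λ u r → node u r (relabel (rotate x) Y)) relabel-cherry₀ (rotate-< x q q<x))
        (relabel-RightSpine (rotate x) (onSpine⇒RightSpine p sp)))
    p₁ = proj₁ p₁-onSpine
    onSpine-p₁ = proj₂ p₁-onSpine

  rotate⁻¹-step : ∀ {t q Y} → L₁.Exceptional t → (p : ParentNode (suc x) (node cherry₁ q Y) t) →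
    onSpine p ≡ true →
    Above (suc (suc x)) Y → q ≢ x →
    let t' = relabel (rotate⁻¹ x) t in
    L₀.Exceptional t' × raiseᵇ t' ≡ false × relabel (rotate x) t' ≡ t
  rotate⁻¹-step {t} {q} {Y} (inT@(cit , _ , _) , h , _) p sp Y-above q≢x =
    (inT' , subst₂ (HasChild t') (rotate⁻¹-1+x x) (rotate⁻¹-2+x x) (relabel-HasChild (rotate⁻¹ x) h) ,
     L₀.exceptionalᵇ-true p₀ onSpine-p₀) ,
    trans (cong (λ w → rootIs (suc (suc x)) (rightOf (proj₁ w))) (locateParent-ParentNode p₀)) (Y′≢2+x Y Y-above) ,
    relabel-inverse (rotate-rotate⁻¹ x) t
    where
    open Facts (facts cit)
    t' = relabel (rotate⁻¹ x) t
    sS = ParentNode-Subtree p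
    sC : Subtree cherry₁ t
    sC = Subtree-trans (subL subH) sS
    q<x : q < x
    q<x = ≤∧≢⇒< (≤-pred (proj₁ (Subtree-Increasing sS increasing))) q≢x
    noEdge : ∀ {p c} → HasChild t p c → ¬ ((p ≡ x × c ≡ suc x) ⊎ (p ≡ x × c ≡ suc (suc x)))
    noEdge h′ (inj₁ (refl , refl)) =
      q≢x (parent-unique distinct increasing (Subtree⇒HasChild sS (inj₁ refl)) h′)
    noEdge h′ (inj₂ (refl , refl)) = <-irrefl (parent-unique distinct increasing h′ h) (n<1+n x)
    Y≢x : ∀ {Y} → Above (suc (suc x)) Y → ¬ RootLabel x Y
    Y≢x {node _ _ _} 2+x<x refl = <-asym 2+x<x x<2+x
    noSib : ∀ {a b} → AreSiblings a b t → ¬ ((a ≡ x × b ≡ suc x) ⊎ (a ≡ x × b ≡ suc (suc x)))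
    noSib (u , a , v , s′ , inj₁ (ru , rv)) (inj₁ (refl , refl))
      with parent-node-unique distinct increasing s′ (inj₂ rv) sS (inj₁ refl)
    ... | refl = 1+n≢n ru
    noSib (u , a , v , s′ , inj₂ (ru , rv)) (inj₁ (refl , refl))
      with parent-node-unique distinct increasing s′ (inj₁ ru) sS (inj₁ refl)
    ... | refl = Y≢x Y-above rv
    noSib (u , a , v , s′ , inj₁ (ru , rv)) (inj₂ (refl , refl))
      with parent-node-unique distinct increasing s′ (inj₂ rv) sC (inj₂ refl)
    ... | refl = <-irrefl (sym ru) (<-trans x<2+x 2+x<N)
    noSib (u , a , v , s′ , inj₂ (ru , rv)) (inj₂ (refl , refl))
      with parent-node-unique distinct increasing s′ (inj₁ ru) sC (inj₂ refl)
    ... | refl = <-irrefl (sym rv) x<2+x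
    compatible : Compatible (rotate⁻¹ x) t
    compatible = Compatible-avoiding (rotate⁻¹ x) _ t increasing
      (λ lt bad → rotate⁻¹-mono x lt (bad ∘ inj₁) (bad ∘ inj₂)) noEdge noSib
    inT' : InClass N (suc x) x t'
    inT' =
      subst₂ (λ m k → InClass N m k t') (rotate⁻¹-2+x x) (rotate⁻¹-1+x x) (relabel-InClass rotation⁻¹ compatible inT)
    p₀-onSpine = RightSpine⇒ParentNode 2≤x (proj₁ inT') (inj₁ refl)
      (subst (λ w → RightSpine w t')
        (cong₂ (λ u r → node u r (relabel (rotate⁻¹ x) Y)) relabel-cherry₁ (rotate⁻¹-< x q q<x))
        (relabel-RightSpine (rotate⁻¹ x) (onSpine⇒RightSpine p sp)))
    p₀ = proj₁ p₀-onSpine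
    onSpine-p₀ = proj₂ p₀-onSpine
    Y′≢2+x : ∀ Y → Above (suc (suc x)) Y → rootIs (suc (suc x)) (relabel (rotate⁻¹ x) Y) ≡ false
    Y′≢2+x nil _ = refl
    Y′≢2+x (node _ c _) 2+x<c = ≡ᵇ-false (λ e′ → <-irrefl (sym (trans (sym (rotate⁻¹-> x c 2+x<c)) e′)) 2+x<c)

  private
    shiftUp-by-raise : ∀ {t} → raiseᵇ t ≡ true →
      L₁.Exceptional (atParent x raise t) × lowerᵇ (atParent x raise t) ≡ true ×
        atParent x lower (atParent x raise t) ≡ t →
      L₁.Exceptional (shiftUp t) × shiftDown (shiftUp t) ≡ t
    shiftUp-by-raise up (ex , down , inverse) rewrite up | down = ex , inverse

    shiftUp-by-rotate : ∀ {t} → raiseᵇ t ≡ false →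
      L₁.Exceptional (relabel (rotate x) t) × lowerᵇ (relabel (rotate x) t) ≡ false ×
        relabel (rotate⁻¹ x) (relabel (rotate x) t) ≡ t →
      L₁.Exceptional (shiftUp t) × shiftDown (shiftUp t) ≡ t
    shiftUp-by-rotate up (ex , down , inverse) rewrite up | down = ex , inverse

    shiftDown-by-lower : ∀ {t} → lowerᵇ t ≡ true →
      L₀.Exceptional (atParent x lower t) × raiseᵇ (atParent x lower t) ≡ true ×
        atParent x raise (atParent x lower t) ≡ t →
      L₀.Exceptional (shiftDown t) × shiftUp (shiftDown t) ≡ t
    shiftDown-by-lower down (ex , up , inverse) rewrite down | up = ex , inverse

    shiftDown-by-rotate : ∀ {t} → lowerᵇ t ≡ false →
      L₀.Exceptional (relabel (rotate⁻¹ x) t) × raiseᵇ (relabel (rotate⁻¹ x) t) ≡ false ×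
        relabel (rotate x) (relabel (rotate⁻¹ x) t) ≡ t →
      L₀.Exceptional (shiftDown t) × shiftUp (shiftDown t) ≡ t
    shiftDown-by-rotate down (ex , up , inverse) rewrite down | up = ex , inverse

  shiftUp-ok : ∀ {t} → L₀.Exceptional t → L₁.Exceptional (shiftUp t) × shiftDown (shiftUp t) ≡ t
  shiftUp-ok {t} ex@(inT , _) = go Y parent parent-onSpine
    (cong (λ w → rootIs (suc (suc x)) (rightOf (proj₁ w))) (locateParent-ParentNode parent))
    where
    open L₀.ExceptionalView (L₀.exceptionalView ex)
    go : ∀ Y (p : ParentNode x (node cherry₀ q Y) t) → onSpine p ≡ true →
      raiseᵇ t ≡ rootIs (suc (suc x)) Y → L₁.Exceptional (shiftUp t) × shiftDown (shiftUp t) ≡ t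
    go nil p sp up = shiftUp-by-rotate up (rotate-step ex p sp refl)
    go (node L c R) p sp up with c ≟ suc (suc x)
    ... | yes refl = shiftUp-by-raise (trans up (≡ᵇ-refl (suc (suc x)))) (raise-step inT p sp)
    ... | no c≢2+x = shiftUp-by-rotate (trans up (≡ᵇ-false c≢2+x)) (rotate-step ex p sp (≡ᵇ-false c≢2+x))

  -- when x is the parent of x + 1, the node x lies on the right spine below its parent
  shiftDown-ok : ∀ {t} → L₁.Exceptional t → L₀.Exceptional (shiftDown t) × shiftUp (shiftDown t) ≡ t
  shiftDown-ok {t} ex@(inT@(cit , _) , _) with L₁.exceptionalView ex
  ... | view with L₁.ExceptionalView.q view ≟ x
  ...   | no q≢x = shiftDown-by-rotate (trans down (dec-false (q ≟ x) q≢x))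
                     (rotate⁻¹-step ex parent parent-onSpine Y-above q≢x)
    where
    open L₁.ExceptionalView view
    down = cong (λ w → does (root (proj₁ w) ≟ x)) (locateParent-ParentNode parent)
  ...   | yes refl = shiftDown-by-lower (trans down (dec-true (x ≟ x) refl)) (lower-step inT p′ onSpine-p′)
    where
    open L₁.ExceptionalView view
    open Facts (facts cit)
    down = cong (λ w → does (root (proj₁ w) ≟ x)) (locateParent-ParentNode parent)
    above = RightSpine-parent (onSpine⇒RightSpine parent parent-onSpine)
      (λ e → L₀.root≢x rootLabel (cong root (sym e)))
    p′-onSpine = RightSpine⇒ParentNode 2≤x cit (inj₂ refl) (proj₂ (proj₂ above))
    p′ = proj₁ p′-onSpine
    onSpine-p′ = proj₂ p′-onSpine

  shift : Refinement Tree L₀.Exceptional ↔ Refinement Tree L₁.Exceptional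
  shift = Refinement-↔ L₀.Exceptional? L₁.Exceptional? shiftUp shiftDown shiftUp-ok shiftDown-ok

proposition6p2 : (n k : ℕ) → 1 ≤ n → 3 ≤ k → k ≤ 2 * n ∸ 2 →
    (a b c d : ℕ) →
    HasCard (F n (k ∸ 1) k) a → HasCard (F n (k + 1) k) b →
    HasCard (F n k (k ∸ 1)) c → HasCard (F n k (k + 1)) d →
    a + b ≡ c + d
proposition6p2 n (suc x) 1≤n (s≤s 2≤x) k≤2n∸2 a b c d ha hb hc hd = ↔⇒≡ (begin
  Fin (a + b)                 ↔⟨ +↔⊎ ⟩
  (Fin a ⊎ Fin b)             ↔⟨ ha ⊎-↔ subst (λ m → Fin b ↔ F n m (suc x)) (+-comm (suc x) 1) hb ⟩
  (F n x (suc x) ⊎ F n (suc (suc x)) (suc x))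
    ↔⟨ exchange L₀.decomposition L₁.decomposition shift ⟩
  (F n (suc x) x ⊎ F n (suc x) (suc (suc x)))
    ↔⟨ ↔-sym (hc ⊎-↔ subst (λ m → Fin d ↔ F n (suc x) m) (+-comm (suc x) 1) hd) ⟩
  (Fin c ⊎ Fin d)             ↔⟨ ↔-sym +↔⊎ ⟩
  Fin (c + d)                 ∎)
  where
  open EquationalReasoning
  2+x<2n : suc (suc x) < 2 * n
  2+x<2n =
    subst (_≤ 2 * n) (+-comm (suc x) 2) (≤-trans (+-monoˡ-≤ 2 k≤2n∸2) (≤-reflexive (m∸n+n≡m (*-monoʳ-≤ 2 1≤n))))
  open ExceptionalShift (2 * n) x 2≤x 2+x<2n (trans (cong (_% 2) (*-comm 2 n)) (m*n%n≡0 n 2))
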